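{- Let $(P,\omega)$ be a sign-graded poset of rank $r$ with $|P|=p$, where $\omega$ is canonical, and let $\pi\in\mathcal{L}(P,\omega)$. Then $$\sum_{\sigma\in\operatorname{Orb}(\pi)}t^{\operatorname{des}(\sigma)}=t^{\operatorname{des}(\hat{\pi})}(1+t)^{p-r-1-2\operatorname{des}(\hat{\pi})}.$$ Moreover, if $r=0$ then $\operatorname{peak}$ is constant on the orbits of the $\mathbb{Z}_2^P$-action and $\operatorname{peak}(\pi)=\operatorname{des}(\hat{\pi})$ for all $\pi\in\mathcal{L}(P,\omega)$.
   Context: A labeled poset is a pair $(P,\omega)$ with $P$ a finite poset and $\omega:P\to\mathbb{Z}$ injective. Its Jordan–Hölder set $\mathcal{L}(P,\omega)$ is the set of words $\pi=a_1\cdots a_p$ ($p=|P|$) that are permutations of $\omega(P)$ such that $x<_Py$ implies $\omega(x)$ precedes $\omega(y)$ in $\pi$. For a cover relation $x\lessdot y$ of $P$ set $\epsilon(x,y)=1$ if $\omega(x)<\omega(y)$ and $-1$ otherwise. $(P,\omega)$ is sign-graded if the sum of $\epsilon$ along every maximal chain of $P$ is the same number $r$, the rank; then $\rho(x)$ is the sum of $\epsilon$ along any saturated chain from a minimal element to $x$. The labeling $\omega$ is canonical if $(P,\omega)$ is sign-graded, $\rho$ takes values in $\{0,1\}$, all elements of rank $0$ have negative labels and all elements of rank $1$ have positive labels. For $\pi=a_1\cdots a_p\in\mathcal{L}(P,\omega)$ set $a_0=a_{p+1}=0$ and classify each letter $a_k$ ($1\le k\le p$) as a valley, peak, double ascent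 or double descent according as $a_{k-1}>a_k<a_{k+1}$, $a_{k-1}<a_k>a_{k+1}$, $a_{k-1}<a_k<a_{k+1}$, or $a_{k-1}>a_k>a_{k+1}$. For $x\in\omega(P)$ define $\psi_x(\pi)$: if $x<0$ is a double descent, move $x$ to between the first pair of consecutive letters $a_i,a_{i+1}$ to the right of $x$ with $a_i<x<a_{i+1}$; if $x<0$ is a double ascent, move $x$ to between the first pair $a_i,a_{i+1}$ to the left of $x$ with $a_i>x>a_{i+1}$; if $x>0$ is a double descent, move $x$ to between the first pair $a_i,a_{i+1}$ to the left of $x$ with $a_i<x<a_{i+1}$; if $x>0$ is a double ascent, move $x$ to between the first pair $a_i,a_{i+1}$ to the right of $x$ with $a_i>x>a_{i+1}$; if $x$ is a peak or valley, $\psi_x(\pi)=\pi$ (here $a_0,a_{p+1}$ are allowed as members of the pairs). For canonical $\omega$ these maps send $\mathcal{L}(P,\omega)$ to itself and are commuting involutions, giving an action of $\mathbb{Z}_2^P$ via $\psi_S=\prod_{x\in S}\psi_{\omega(x)}$, $S\subseteq P$; $\operatorname{Orb}(\pi)=\{\psi_S(\pi):S\subseteq P\}$, and $\hat{\pi}$ denotes the unique element of $\operatorname{Orb}(\pi)$ such that $0\hat{\pi}0$ has no double descents. $\operatorname{des}(\pi)=|\{i\in[p-1]:a_i>a_{i+1}\}|$ and $\operatorname{peak}(\pi)=|\{i\in\{2,\dots,p-1\}:a_{i-1}<a_i>a_{i+1}\}|$. -}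

module Defs where

open import Data.Bool using (Bool; true; false; if_then_else_; _∧_)
open import Data.Nat as ℕ using (ℕ; zero; suc)
open import Data.Integer as ℤ using (ℤ; +_; -1ℤ; 0ℤ; 1ℤ)
import Data.Integer.Properties as ℤP
open import Data.Fin using (Fin)
open import Data.List using (List; []; _∷_; _++_; map; allFin; reverse; foldr; deduplicate)
import Data.List.Properties as LP
open import Data.List.Relation.Binary.Permutation.Propositional using (_↭_)
open import Data.Vec using (Vec; []; _∷_; lookup)
open import Data.Maybe using (Maybe; just; nothing)
open import Data.Product using (Σ; ∃; _×_; _,_)
open import Data.Sum using (_⊎_)
open import Relation.Nullary using (¬_; does)
open import Relation.Binary.PropositionalEquality using (_≡_; _≢_)
open import Relation.Binary.Structures using (IsPartialOrder)
open import Function.Definitions using (Injective)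

record LabeledPoset (p : ℕ) : Set₁ where
  field
    _≤P_           : Fin p → Fin p → Set
    isPartialOrder : IsPartialOrder _≡_ _≤P_
    ω              : Fin p → ℤ
    ω-injective    : Injective _≡_ _≡_ ω

  _<P_ : Fin p → Fin p → Set
  x <P y = x ≤P y × x ≢ y

  _⋖_ : Fin p → Fin p → Set
  x ⋖ y = x <P y × (∀ z → x <P z → ¬ (z <P y))

  Minimal : Fin p → Set
  Minimal x = ∀ y → ¬ (y <P x)

  Maximal : Fin p → Set
  Maximal x = ∀ y → ¬ (x <P y)

  ε : Fin p → Fin p → ℤ
  ε x y = if does (ω x ℤP.<? ω y) then 1ℤ else -1ℤ

  data SatChain : Fin p → Fin p → Set where
    single : ∀ x → SatChain x x
    step   : ∀ {x y z} → x ⋖ y → SatChain y z → SatChain x z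

  weight : ∀ {x z} → SatChain x z → ℤ
  weight (single x)            = 0ℤ
  weight (step {x} {y} _ c)    = ε x y ℤ.+ weight c

  -- maximal chains of a finite poset = saturated chains from a minimal
  -- to a maximal element
  SignGraded : ℤ → Set
  SignGraded r = ∀ x y → Minimal x → Maximal y → (c : SatChain x y) → weight c ≡ r

  HasRank : Fin p → ℤ → Set
  HasRank x v = ∀ m → Minimal m → (c : SatChain m x) → weight c ≡ v

  Canonical : ℤ → Set
  Canonical r = SignGraded r
              × (∀ x → (HasRank x 0ℤ × ω x ℤ.< 0ℤ) ⊎ (HasRank x 1ℤ × 0ℤ ℤ.< ω x))

Precedes : ℤ → ℤ → List ℤ → Set
Precedes a b π = ∃ λ as → ∃ λ bs → ∃ λ cs → π ≡ as ++ (a ∷ bs) ++ (b ∷ cs)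

module _ {p : ℕ} (P : LabeledPoset p) where
  open LabeledPoset P

  InJH : List ℤ → Set
  InJH π = (π ↭ map ω (allFin p)) × (∀ x y → x <P y → Precedes (ω x) (ω y) π)

ltᵇ : ℤ → ℤ → Bool
ltᵇ a b = does (a ℤP.<? b)

des : List ℤ → ℕ
des (a ∷ b ∷ rest) = (if ltᵇ b a then 1 else 0) ℕ.+ des (b ∷ rest)
des _              = 0

peak : List ℤ → ℕ
peak (a ∷ b ∷ c ∷ rest) = (if ltᵇ a b ∧ ltᵇ c b then 1 else 0) ℕ.+ peak (b ∷ c ∷ rest)
peak _                  = 0

countDD : List ℤ → ℕ
countDD (a ∷ b ∷ c ∷ rest) = (if ltᵇ b a ∧ ltᵇ c b then 1 else 0) ℕ.+ countDD (b ∷ c ∷ rest)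
countDD _                  = 0

NoDD : List ℤ → Set
NoDD σ = countDD (0ℤ ∷ σ ++ 0ℤ ∷ []) ≡ 0

-- insert x between the first consecutive pair (a,b) of (R ++ [0])
-- satisfying cond a b (scanning left to right)
insR : (ℤ → ℤ → Bool) → ℤ → List ℤ → List ℤ
insR cond x []            = x ∷ []
insR cond x (a ∷ [])      = if cond a 0ℤ then a ∷ x ∷ [] else a ∷ x ∷ []
insR cond x (a ∷ b ∷ rest) =
  if cond a b then a ∷ x ∷ b ∷ rest else a ∷ insR cond x (b ∷ rest)

-- insert x between the first consecutive pair (a,b) of ([0] ++ L)
-- satisfying cond a b (scanning right to left)
insL : (ℤ → ℤ → Bool) → ℤ → List ℤ → List ℤ
insL cond x L = reverse (insR (λ b a → cond a b) x (reverse L))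

splitAt : ℤ → List ℤ → Maybe (List ℤ × List ℤ)
splitAt x []      = nothing
splitAt x (a ∷ π) with does (a ℤP.≟ x)
... | true  = just ([] , π)
... | false with splitAt x π
...   | nothing       = nothing
...   | just (L , R)  = just (a ∷ L , R)

lastOr0 : List ℤ → ℤ
lastOr0 []           = 0ℤ
lastOr0 (a ∷ [])     = a
lastOr0 (a ∷ b ∷ l)  = lastOr0 (b ∷ l)

headOr0 : List ℤ → ℤ
headOr0 []      = 0ℤ
headOr0 (a ∷ _) = a

between : ℤ → ℤ → ℤ → Bool
between a x b = ltᵇ a x ∧ ltᵇ x b

ψ : ℤ → List ℤ → List ℤ
ψ x π with splitAt x π
... | nothing      = π
... | just (L , R) =
  let l = lastOr0 L ; r = headOr0 R in
  if ltᵇ x 0ℤ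
  then (if between r x l
        then L ++ insR (λ a b → between a x b) x R
        else if between l x r
        then insL (λ a b → between b x a) x L ++ R
        else π)
  else if ltᵇ 0ℤ x
  then (if between r x l
        then insL (λ a b → between a x b) x L ++ R
        else if between l x r
        then L ++ insR (λ a b → between b x a) x R
        else π)
  else π

Subset : ℕ → Set
Subset n = Vec Bool n

allSubsets : ∀ n → List (Subset n)
allSubsets zero    = [] ∷ []
allSubsets (suc n) = map (true ∷_) (allSubsets n) ++ map (false ∷_) (allSubsets n)

module _ {p : ℕ} (P : LabeledPoset p) where
  open LabeledPoset P

  ψS : Subset p → List ℤ → List ℤ
  ψS S π = foldr (λ x acc → if lookup S x then ψ (ω x) acc else acc) π (allFin p)

  InOrb : List ℤ → List ℤ → Set
  InOrb σ π = ∃ λ (S : Subset p) → ψS S π ≡ σ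

  orbit : List ℤ → List (List ℤ)
  orbit π = deduplicate (LP.≡-dec ℤP._≟_) (map (λ S → ψS S π) (allSubsets p))

  orbitPoly : List ℤ → ℤ → ℤ
  orbitPoly π t = foldr ℤ._+_ 0ℤ (map (λ σ → t ℤ.^ des σ) (orbit π))

-- Mark each letter a of a word τ by whether its left and right neighbours in 0τ0 are smaller than
-- a.  For x ≢ 0, ψ x either fixes τ (x a peak or valley) or moves x across a maximal run of letters
-- lying beyond x as seen from 0; every other letter compares alike with x and with that run, so the
-- move swaps the two marks of x and changes no other mark.  Thus ψ_S π is π with the marks of the
-- letters of S swapped, and the orbit of π is a cube over its m double ascents and descents.  As
-- des σ + [last letter of σ > 0] counts peaks and double descents of 0σ0, summing over the cube gives
-- t ^ des π̂ · (1 + t) ^ m.  The first letter of π is minimal, hence negative, and the last one is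
-- maximal, whence r = [last letter > 0]; peaks and valleys of 0π0 alternate, which gives
-- p = 2 des π̂ + r + 1 + m.  For r = 0, peak counts exactly the peaks of 0π0, and these never move.

module Submission where

open import Defs
open import Data.Bool using (Bool; true; false; if_then_else_; _∧_; not; _xor_)
open import Data.Bool.Properties using (∧-identityʳ; ∧-zeroʳ; ∧-comm; xor-identityʳ; not-¬)
open import Data.Empty using (⊥-elim)
open import Data.Fin as Fin using (Fin)
import Data.Fin.Properties as FinP
open import Data.Integer as ℤ using (ℤ; +_; _+_; _-_; _*_; _^_; 0ℤ; 1ℤ)
import Data.Integer.Properties as ℤP
import Data.Integer.Tactic.RingSolver as ℤSolver
open import Data.List as List using (List; []; _∷_; _++_; map; reverse; [_]; foldr; allFin)
import Data.List.Properties as ListP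
open import Data.List.Membership.Propositional using (_∈_)
open import Data.List.Membership.Propositional.Properties
  using (∈-allFin; ∈-map⁺; ∈-map⁻; ∈-++⁺ˡ; ∈-++⁺ʳ; ∈-++⁻; ∈-deduplicate⁻; ∈-deduplicate⁺)
open import Data.List.Membership.Propositional.Properties.WithK using (unique∧set⇒bag)
open import Data.List.Relation.Binary.BagAndSetEquality using (∼bag⇒↭)
open import Data.List.Relation.Binary.Permutation.Propositional as Perm
  using (_↭_; ↭-refl; ↭-sym; ↭-trans; ↭-reflexive; ↭⇒↭ₛ)
import Data.List.Relation.Binary.Permutation.Propositional.Properties as PermP
import Data.List.Relation.Binary.Permutation.Setoid.Properties as PermS
open import Data.List.Relation.Unary.All as All using (All; []; _∷_)
import Data.List.Relation.Unary.All.Properties as AllP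
open import Data.List.Relation.Unary.AllPairs using ([]; _∷_)
open import Data.List.Relation.Unary.Any using (here; there)
open import Data.List.Relation.Unary.Unique.Propositional using (Unique)
import Data.List.Relation.Unary.Unique.Propositional.Properties as UniqueP
import Data.List.Relation.Unary.Unique.DecPropositional.Properties as UniqueDecP
open import Data.Maybe using (just; nothing)
open import Data.Nat as ℕ using (ℕ; zero; suc; NonZero)
open import Data.Nat.ListAction using (sum)
open import Data.Nat.ListAction.Properties using (sum-↭)
import Data.Nat.Properties as ℕP
open import Algebra.Properties.CommutativeMonoid.Sum ℕP.+-0-commutativeMonoid
  using (sum-syntax; sum-cong-≗; ∑-distrib-+; sum-replicate-zero)
import Data.Nat.Tactic.RingSolver as ℕSolver
open import Data.Product using (∃; ∃₂; _×_; _,_; proj₁; proj₂)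
open import Data.Sum using (_⊎_; inj₁; inj₂)
open import Data.Vec as Vec using (lookup; []; _∷_)
import Data.Vec.Properties as VecP
open import Function using (id; _∘_; case_of_)
open import Function.Bundles using (mk⇔)
open import Relation.Binary.Definitions using (tri<; tri≈; tri>)
open import Relation.Binary.PropositionalEquality
  using (_≡_; _≢_; refl; sym; trans; cong; cong₂; subst; subst₂; ≢-sym; setoid; module ≡-Reasoning)
open import Relation.Binary.Structures using (IsPartialOrder)
open import Relation.Nullary using (¬_; Dec; yes; no; does)
open import Relation.Nullary.Decidable using (dec-true; dec-false; ¬¬-excluded-middle; decidable-stable)

unique-resp-↭ : ∀ {A : Set} {xs ys : List A} → Unique xs → xs ↭ ys → Unique ys
unique-resp-↭ {A} u p = PermS.Unique-resp-↭ (setoid A) (↭⇒↭ₛ p) u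

ltᵇ-complete : ∀ {a b} → a ℤ.< b → ltᵇ a b ≡ true
ltᵇ-complete {a} {b} = dec-true (a ℤP.<? b)

ltᵇ-false : ∀ a b → ¬ (a ℤ.< b) → ltᵇ a b ≡ false
ltᵇ-false a b = dec-false (a ℤP.<? b)

ltᵇ-sound : ∀ a b → ltᵇ a b ≡ true → a ℤ.< b
ltᵇ-sound a b h with a ℤP.<? b
... | yes a<b = a<b
... | no _ with () ← h

ltᵇ-asym : ∀ a b → ltᵇ a b ≡ true → ltᵇ b a ≡ false
ltᵇ-asym a b h = ltᵇ-false b a (ℤP.<-asym (ltᵇ-sound a b h))

ltᵇ-trans : ∀ a b c → ltᵇ a b ≡ true → ltᵇ b c ≡ true → ltᵇ a c ≡ true
ltᵇ-trans a b c h₁ h₂ = ltᵇ-complete (ℤP.<-trans (ltᵇ-sound a b h₁) (ltᵇ-sound b c h₂))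

ltᵇ-irrefl : ∀ a → ltᵇ a a ≡ false
ltᵇ-irrefl a = ltᵇ-false a a (ℤP.<-irrefl refl)

data Compare≢ (a b : ℤ) : Set where
  less    : ltᵇ a b ≡ true  → ltᵇ b a ≡ false → Compare≢ a b
  greater : ltᵇ a b ≡ false → ltᵇ b a ≡ true  → Compare≢ a b

compare≢ : ∀ a b → a ≢ b → Compare≢ a b
compare≢ a b a≢b with ℤP.<-cmp a b
... | tri< a<b _ b≮a = less (ltᵇ-complete a<b) (ltᵇ-false b a b≮a)
... | tri≈ _ a≡b _   = ⊥-elim (a≢b a≡b)
... | tri> a≮b _ b<a = greater (ltᵇ-false a b a≮b) (ltᵇ-complete b<a)

ltᵇ-flip : ∀ a b → a ≢ b → ltᵇ a b ≡ not (ltᵇ b a)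
ltᵇ-flip a b a≢b with compare≢ a b a≢b
... | less    ab ba rewrite ab | ba = refl
... | greater ab ba rewrite ab | ba = refl

if-same : ∀ {A : Set} (b : Bool) (x : A) → (if b then x else x) ≡ x
if-same true  x = refl
if-same false x = refl

if-true : ∀ {A : Set} {b : Bool} {u v : A} → b ≡ true → (if b then u else v) ≡ u
if-true refl = refl

if-false : ∀ {A : Set} {b : Bool} {u v : A} → b ≡ false → (if b then u else v) ≡ v
if-false refl = refl

∧-true : ∀ {a b} → a ∧ b ≡ true → a ≡ true × b ≡ true
∧-true {true} {true} _ = refl , refl

bool-cases : ∀ b → b ≡ true ⊎ b ≡ false
bool-cases true  = inj₁ refl
bool-cases false = inj₂ refl

-- Marks of the letters of a word

-- (a , l , n): the letter a, whether its left neighbour is smaller, whether its right one is.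
-- (true , true) is a peak, (false , false) a valley, (false , true) a double descent and
-- (true , false) a double ascent.
Entry : Set
Entry = ℤ × Bool × Bool

signatureFrom : ℤ → List ℤ → List Entry
signatureFrom p []         = []
signatureFrom p (a ∷ rest) = (a , ltᵇ p a , ltᵇ (headOr0 rest) a) ∷ signatureFrom a rest

signature : List ℤ → List Entry
signature = signatureFrom 0ℤ

signatureWithin : ℤ → List ℤ → ℤ → List Entry
signatureWithin p []            q = []
signatureWithin p (a ∷ [])      q = (a , ltᵇ p a , ltᵇ q a) ∷ []
signatureWithin p (a ∷ b ∷ rest) q = (a , ltᵇ p a , ltᵇ b a) ∷ signatureWithin a (b ∷ rest) q

lastOf : ℤ → List ℤ → ℤ
lastOf p []      = p
lastOf p (a ∷ l) = lastOf a l

lastOr0≡lastOf : ∀ L → lastOr0 L ≡ lastOf 0ℤ L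
lastOr0≡lastOf []          = refl
lastOr0≡lastOf (a ∷ [])    = refl
lastOr0≡lastOf (a ∷ b ∷ L) = lastOr0≡lastOf (b ∷ L)

lastOf-++ : ∀ p L M → lastOf p (L ++ M) ≡ lastOf (lastOf p L) M
lastOf-++ p []      M = refl
lastOf-++ p (a ∷ L) M = lastOf-++ a L M

signatureFrom-++ : ∀ p L M →
  signatureFrom p (L ++ M) ≡ signatureWithin p L (headOr0 M) ++ signatureFrom (lastOf p L) M
signatureFrom-++ p []          M = refl
signatureFrom-++ p (a ∷ [])    M = refl
signatureFrom-++ p (a ∷ b ∷ L) M = cong (_ ∷_) (signatureFrom-++ a (b ∷ L) M)

letters-signatureFrom : ∀ p L → map proj₁ (signatureFrom p L) ≡ L
letters-signatureFrom p []      = refl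
letters-signatureFrom p (a ∷ L) = cong (a ∷_) (letters-signatureFrom a L)

letters-signatureWithin : ∀ p L q → map proj₁ (signatureWithin p L q) ≡ L
letters-signatureWithin p []          q = refl
letters-signatureWithin p (a ∷ [])    q = refl
letters-signatureWithin p (a ∷ b ∷ L) q = cong (a ∷_) (letters-signatureWithin a (b ∷ L) q)

signatureWithin-congˡ : ∀ p p′ L q → ltᵇ p (headOr0 L) ≡ ltᵇ p′ (headOr0 L) →
                        signatureWithin p L q ≡ signatureWithin p′ L q
signatureWithin-congˡ p p′ []          q e = refl
signatureWithin-congˡ p p′ (a ∷ [])    q e = cong (λ z → (a , z , ltᵇ q a) ∷ []) e
signatureWithin-congˡ p p′ (a ∷ b ∷ L) q e = cong (λ z → (a , z , ltᵇ b a) ∷ signatureWithin a (b ∷ L) q) e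

signatureWithin-congʳ : ∀ p L q q′ → ltᵇ q (lastOf p L) ≡ ltᵇ q′ (lastOf p L) →
                        signatureWithin p L q ≡ signatureWithin p L q′
signatureWithin-congʳ p []          q q′ e = refl
signatureWithin-congʳ p (a ∷ [])    q q′ e = cong (λ z → (a , ltᵇ p a , z) ∷ []) e
signatureWithin-congʳ p (a ∷ b ∷ L) q q′ e = cong (_ ∷_) (signatureWithin-congʳ a (b ∷ L) q q′ e)

signatureFrom-congˡ : ∀ p p′ L → ltᵇ p (headOr0 L) ≡ ltᵇ p′ (headOr0 L) →
                      signatureFrom p L ≡ signatureFrom p′ L
signatureFrom-congˡ p p′ []      e = refl
signatureFrom-congˡ p p′ (a ∷ L) e = cong (λ z → (a , z , ltᵇ (headOr0 L) a) ∷ signatureFrom a L) e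

flipAt : ℤ → Entry → Entry
flipAt x (a , l , n) = if does (a ℤP.≟ x) then (a , n , l) else (a , l , n)

entryOf : ℤ → List Entry → Entry
entryOf k []                 = (k , false , false)
entryOf k ((a , l , n) ∷ es) = if does (a ℤP.≟ k) then (a , l , n) else entryOf k es

Balanced : Entry → Set
Balanced (_ , l , n) = l ≡ n

flipAt-≢ : ∀ x e → proj₁ e ≢ x → flipAt x e ≡ e
flipAt-≢ x (a , l , n) a≢x rewrite dec-false (a ℤP.≟ x) a≢x = refl

flipAt-≡ : ∀ x l n → flipAt x (x , l , n) ≡ (x , n , l)
flipAt-≡ x l n rewrite dec-true (x ℤP.≟ x) refl = refl

flipAt-involutive : ∀ x e → flipAt x (flipAt x e) ≡ e
flipAt-involutive x (a , l , n) with a ℤP.≟ x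
... | yes refl rewrite dec-true (a ℤP.≟ a) refl = refl
... | no a≢x   rewrite dec-false (a ℤP.≟ x) a≢x = refl

flipAt-balanced : ∀ x e → Balanced e → flipAt x e ≡ e
flipAt-balanced x (a , l , .l) refl = if-same (does (a ℤP.≟ x)) _

balanced-flipAt : ∀ x e → Balanced (flipAt x e) → Balanced e
balanced-flipAt x (a , l , n) b with a ℤP.≟ x
... | yes _ = sym b
... | no _  = b

map-flipAt-∉ : ∀ x E → All (_≢ x) (map proj₁ E) → map (flipAt x) E ≡ E
map-flipAt-∉ x []      _          = refl
map-flipAt-∉ x (e ∷ E) (e≢x ∷ h) = cong₂ _∷_ (flipAt-≢ x e e≢x) (map-flipAt-∉ x E h)

entryOf-letter : ∀ k E → proj₁ (entryOf k E) ≡ k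
entryOf-letter k []                = refl
entryOf-letter k ((a , l , n) ∷ E) with a ℤP.≟ k
... | yes a≡k = a≡k
... | no _    = entryOf-letter k E

entryOf-∉ : ∀ k E → All (_≢ k) (map proj₁ E) → entryOf k E ≡ (k , false , false)
entryOf-∉ k []                _         = refl
entryOf-∉ k ((a , l , n) ∷ E) (a≢k ∷ h) rewrite dec-false (a ℤP.≟ k) a≢k = entryOf-∉ k E h

entryOf-++-∉ : ∀ k A C → All (_≢ k) (map proj₁ A) → entryOf k (A ++ C) ≡ entryOf k C
entryOf-++-∉ k []                C _         = refl
entryOf-++-∉ k ((a , l , n) ∷ A) C (a≢k ∷ h) rewrite dec-false (a ℤP.≟ k) a≢k = entryOf-++-∉ k A C h

entryOf-map-flipAt : ∀ x k E → entryOf k (map (flipAt x) E) ≡ flipAt x (entryOf k E)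
entryOf-map-flipAt x k [] = sym (if-same (does (k ℤP.≟ x)) _)
entryOf-map-flipAt x k ((a , l , n) ∷ E) with a ℤP.≟ x
... | yes refl with a ℤP.≟ k
...   | yes refl rewrite dec-true (a ℤP.≟ a) refl = refl
...   | no _     = entryOf-map-flipAt x k E
entryOf-map-flipAt x k ((a , l , n) ∷ E) | no a≢x with a ℤP.≟ k
...   | yes refl rewrite dec-false (a ℤP.≟ x) a≢x = refl
...   | no _     = entryOf-map-flipAt x k E

entryOf-↭ : ∀ k {E E′} → Unique (map proj₁ E) → E ↭ E′ → entryOf k E ≡ entryOf k E′
entryOf-↭ k u Perm.refl = refl
entryOf-↭ k (_ ∷ u) (Perm.prep (a , l , n) p) with a ℤP.≟ k
... | yes _ = refl
... | no _  = entryOf-↭ k u p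
entryOf-↭ k ((a₁≢a₂ ∷ _) ∷ (_ ∷ u)) (Perm.swap (a₁ , _) (a₂ , _) p) with a₁ ℤP.≟ k | a₂ ℤP.≟ k
... | yes refl | yes refl = ⊥-elim (a₁≢a₂ refl)
... | yes _    | no _     = refl
... | no _     | yes _    = refl
... | no _     | no _     = entryOf-↭ k u p
entryOf-↭ k u (Perm.trans p q) =
  trans (entryOf-↭ k u p) (entryOf-↭ k (unique-resp-↭ u (PermP.map⁺ proj₁ p)) q)

entryOf-signature : ∀ x L R → All (_≢ x) L →
  entryOf x (signature (L ++ x ∷ R)) ≡ (x , ltᵇ (lastOf 0ℤ L) x , ltᵇ (headOr0 R) x)
entryOf-signature x L R x∉L
  rewrite signatureFrom-++ 0ℤ L (x ∷ R)
        | entryOf-++-∉ x (signatureWithin 0ℤ L x) (signatureFrom (lastOf 0ℤ L) (x ∷ R))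
            (subst (All (_≢ x)) (sym (letters-signatureWithin 0ℤ L x)) x∉L)
        | dec-true (x ℤP.≟ x) refl
  = refl

-- The moves ψ x

-- β: the letters ψ x can jump over, those smaller than x if x < 0 and those larger than x if x > 0.
record JumpSet (x : ℤ) (β : ℤ → Bool) : Set where
  field
    β-below        : Bool
    β-vs-x         : ∀ b → β b ≡ true → ltᵇ b x ≡ β-below
    outside-vs-x   : ∀ n → β n ≡ false → n ≢ x → ltᵇ n x ≡ not β-below
    x-like-β       : ∀ n b → β n ≡ false → n ≢ x → β b ≡ true → ltᵇ x n ≡ ltᵇ b n
    outside-like-x : ∀ n b → β n ≡ false → n ≢ x → β b ≡ true → ltᵇ x b ≡ ltᵇ n b
    β-sign         : ∀ b → β b ≡ true → ltᵇ 0ℤ b ≡ ltᵇ 0ℤ x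
    0∉β            : β 0ℤ ≡ false
    x∉β            : β x ≡ false
    x≢0            : x ≢ 0ℤ

record MaximalRun (β : ℤ → Bool) (x : ℤ) (L B R : List ℤ) : Set where
  field
    before : β (lastOf 0ℤ L) ≡ false
    x∉L    : All (_≢ x) L
    inside : All (λ c → β c ≡ true) B
    after  : β (headOr0 R) ≡ false
    x∉R    : All (_≢ x) R

data Jump (x : ℤ) : List ℤ → List ℤ → Set where
  jump : ∀ {β L b bs R} → JumpSet x β → MaximalRun β x L (b ∷ bs) R →
         Jump x (L ++ x ∷ (b ∷ bs) ++ R) (L ++ (b ∷ bs) ++ x ∷ R)

lastOf-∉ : ∀ {x} p L → p ≢ x → All (_≢ x) L → lastOf p L ≢ x
lastOf-∉ p []      p≢x _           = p≢x
lastOf-∉ p (a ∷ L) p≢x (a≢x ∷ a∉) = lastOf-∉ a L a≢x a∉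

headOr0-∉ : ∀ {x} R → 0ℤ ≢ x → All (_≢ x) R → headOr0 R ≢ x
headOr0-∉ []      0≢x _         = 0≢x
headOr0-∉ (a ∷ R) _   (a≢x ∷ _) = a≢x

lastOf-All : ∀ {P : ℤ → Set} b bs → All P (b ∷ bs) → P (lastOf b bs)
lastOf-All b []       (pb ∷ _)  = pb
lastOf-All b (c ∷ bs) (_ ∷ pbs) = lastOf-All c bs pbs

module _ {x : ℤ} {β : ℤ → Bool} (J : JumpSet x β) where
  open JumpSet J

  private
    0≢x : 0ℤ ≢ x
    0≢x 0≡x = x≢0 (sym 0≡x)

    β⇒≢x : ∀ {B} → All (λ c → β c ≡ true) B → All (_≢ x) B
    β⇒≢x = All.map λ { βc refl → case trans (sym βc) x∉β of λ () }

  jump-signatureFrom : ∀ n b bs R → β n ≡ false → n ≢ x → All (λ c → β c ≡ true) (b ∷ bs) →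
    β (headOr0 R) ≡ false → All (_≢ x) R →
    signatureFrom n ((b ∷ bs) ++ x ∷ R) ↭ map (flipAt x) (signatureFrom n (x ∷ (b ∷ bs) ++ R))
  jump-signatureFrom n b bs R n∉β n≢x B∈β c∉β x∉R =
    ↭-trans (↭-reflexive jumped) (↭-trans (PermP.shift e X Y) (↭-reflexive (sym unjumped)))
    where
      B = b ∷ bs
      bₖ = lastOf b bs
      c = headOr0 R
      c≢x = headOr0-∉ R 0≢x x∉R
      bₖ∈β = lastOf-All b bs B∈β
      b∈β = All.head B∈β
      e = (x , ltᵇ b x , ltᵇ n x)
      X = signatureWithin x B c
      Y = signatureFrom bₖ R
      jumped : signatureFrom n (B ++ x ∷ R) ≡ X ++ [ e ] ++ Y
      jumped = trans (signatureFrom-++ n B (x ∷ R)) (cong₂ _++_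
        (trans (signatureWithin-congˡ n x B x (sym (outside-like-x n b n∉β n≢x b∈β)))
               (signatureWithin-congʳ x B x c (outside-like-x c bₖ c∉β c≢x bₖ∈β)))
        (cong₂ _∷_
          (cong₂ (λ u v → (x , u , v)) (trans (β-vs-x bₖ bₖ∈β) (sym (β-vs-x b b∈β)))
                                       (trans (outside-vs-x c c∉β c≢x) (sym (outside-vs-x n n∉β n≢x))))
          (signatureFrom-congˡ x bₖ R (x-like-β c bₖ c∉β c≢x bₖ∈β))))
      x∉XY : All (_≢ x) (map proj₁ (X ++ Y))
      x∉XY = subst (All (_≢ x))
        (sym (trans (ListP.map-++ proj₁ X Y) (cong₂ _++_ (letters-signatureWithin x B c) (letters-signatureFrom bₖ R))))
        (AllP.++⁺ (β⇒≢x B∈β) x∉R)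
      unjumped : map (flipAt x) (signatureFrom n (x ∷ B ++ R)) ≡ e ∷ X ++ Y
      unjumped = cong₂ _∷_ (flipAt-≡ x (ltᵇ n x) (ltᵇ b x))
        (trans (cong (map (flipAt x)) (signatureFrom-++ x B R)) (map-flipAt-∉ x (X ++ Y) x∉XY))

  jump-signature : ∀ {L b bs R} → MaximalRun β x L (b ∷ bs) R →
    signature (L ++ (b ∷ bs) ++ x ∷ R) ↭ map (flipAt x) (signature (L ++ x ∷ (b ∷ bs) ++ R))
  jump-signature {L} {b} {bs} {R} run =
    ↭-trans (↭-reflexive split)
      (↭-trans (PermP.++⁺ˡ (signatureWithin 0ℤ L x) (jump-signatureFrom l b bs R before l≢x inside after x∉R))
               (↭-reflexive (sym split-flipped)))
    where
      open MaximalRun run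
      l = lastOf 0ℤ L
      l≢x = lastOf-∉ 0ℤ L 0≢x x∉L
      split : signature (L ++ (b ∷ bs) ++ x ∷ R) ≡ signatureWithin 0ℤ L x ++ signatureFrom l ((b ∷ bs) ++ x ∷ R)
      split = trans (signatureFrom-++ 0ℤ L _)
        (cong (_++ signatureFrom l ((b ∷ bs) ++ x ∷ R))
              (signatureWithin-congʳ 0ℤ L b x (sym (x-like-β l b before l≢x (All.head inside)))))
      split-flipped : map (flipAt x) (signature (L ++ x ∷ (b ∷ bs) ++ R))
                      ≡ signatureWithin 0ℤ L x ++ map (flipAt x) (signatureFrom l (x ∷ (b ∷ bs) ++ R))
      split-flipped = trans (cong (map (flipAt x)) (signatureFrom-++ 0ℤ L _))
        (trans (ListP.map-++ (flipAt x) (signatureWithin 0ℤ L x) _)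
               (cong (_++ map (flipAt x) (signatureFrom l (x ∷ (b ∷ bs) ++ R)))
                     (map-flipAt-∉ x _ (subst (All (_≢ x)) (sym (letters-signatureWithin 0ℤ L x)) x∉L))))

  jump-head : ∀ L b bs R → β b ≡ true →
    ltᵇ (headOr0 (L ++ (b ∷ bs) ++ x ∷ R)) 0ℤ ≡ ltᵇ (headOr0 (L ++ x ∷ (b ∷ bs) ++ R)) 0ℤ
  jump-head []      b bs R b∈β = sym (x-like-β 0ℤ b 0∉β 0≢x b∈β)
  jump-head (a ∷ L) b bs R b∈β = refl

  jump-last : ∀ L b bs R → All (λ c → β c ≡ true) (b ∷ bs) →
      (ltᵇ 0ℤ (lastOr0 (L ++ (b ∷ bs) ++ x ∷ R)) ≡ ltᵇ 0ℤ (lastOr0 (L ++ x ∷ (b ∷ bs) ++ R)))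
    × (ltᵇ (lastOr0 (L ++ (b ∷ bs) ++ x ∷ R)) 0ℤ ≡ ltᵇ (lastOr0 (L ++ x ∷ (b ∷ bs) ++ R)) 0ℤ)
  jump-last L b bs R B∈β
    rewrite lastOr0≡lastOf (L ++ (b ∷ bs) ++ x ∷ R) | lastOr0≡lastOf (L ++ x ∷ (b ∷ bs) ++ R)
          | lastOf-++ 0ℤ L ((b ∷ bs) ++ x ∷ R) | lastOf-++ 0ℤ L (x ∷ (b ∷ bs) ++ R)
          | lastOf-++ (lastOf 0ℤ L) (b ∷ bs) (x ∷ R) | lastOf-++ x (b ∷ bs) R = ends R
    where
      ends : ∀ R → (ltᵇ 0ℤ (lastOf x R) ≡ ltᵇ 0ℤ (lastOf (lastOf b bs) R))
                 × (ltᵇ (lastOf x R) 0ℤ ≡ ltᵇ (lastOf (lastOf b bs) R) 0ℤ)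
      ends []      = sym (β-sign _ (lastOf-All b bs B∈β)) , x-like-β 0ℤ _ 0∉β 0≢x (lastOf-All b bs B∈β)
      ends (c ∷ R) = refl , refl

record SameEnds (τ τ′ : List ℤ) : Set where
  field
    ↭-original : τ′ ↭ τ
    head<0     : ltᵇ (headOr0 τ′) 0ℤ ≡ ltᵇ (headOr0 τ) 0ℤ
    last>0     : ltᵇ 0ℤ (lastOr0 τ′) ≡ ltᵇ 0ℤ (lastOr0 τ)
    last<0     : ltᵇ (lastOr0 τ′) 0ℤ ≡ ltᵇ (lastOr0 τ) 0ℤ

sameEnds-refl : ∀ {τ} → SameEnds τ τ
sameEnds-refl = record { ↭-original = ↭-refl ; head<0 = refl ; last>0 = refl ; last<0 = refl }

sameEnds-sym : ∀ {τ τ′} → SameEnds τ τ′ → SameEnds τ′ τ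
sameEnds-sym E = record
  { ↭-original = ↭-sym ↭-original ; head<0 = sym head<0 ; last>0 = sym last>0 ; last<0 = sym last<0 }
  where open SameEnds E

sameEnds-trans : ∀ {τ τ′ τ″} → SameEnds τ τ′ → SameEnds τ′ τ″ → SameEnds τ τ″
sameEnds-trans E E′ = record
  { ↭-original = ↭-trans (↭-original E′) (↭-original E)
  ; head<0     = trans (head<0 E′) (head<0 E)
  ; last>0     = trans (last>0 E′) (last>0 E)
  ; last<0     = trans (last<0 E′) (last<0 E)
  }
  where open SameEnds

record Flipped (x : ℤ) (τ τ′ : List ℤ) : Set where
  field
    sameEnds : SameEnds τ τ′
    entries  : ∀ k → entryOf k (signature τ′) ≡ flipAt x (entryOf k (signature τ))

flipped-sym : ∀ {x τ τ′} → Flipped x τ τ′ → Flipped x τ′ τ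
flipped-sym {x} F = record
  { sameEnds = sameEnds-sym sameEnds
  ; entries  = λ k → trans (sym (flipAt-involutive x _)) (cong (flipAt x) (sym (entries k)))
  }
  where open Flipped F

jump-↭ : ∀ {x τ τ′} → Jump x τ τ′ → τ′ ↭ τ
jump-↭ (jump {L = L} {b} {bs} {R} _ _) = PermP.++⁺ˡ L (PermP.shift _ (b ∷ bs) R)

jump-unbalanced : ∀ {x τ τ′} → Jump x τ τ′ → ¬ Balanced (entryOf x (signature τ))
jump-unbalanced {x} (jump {L = L} {b} {bs} {R} J run) balanced
  rewrite entryOf-signature x L ((b ∷ bs) ++ R) (MaximalRun.x∉L run) = not-¬ refl (sym
    (trans (sym (outside-vs-x _ before (lastOf-∉ 0ℤ L (≢-sym x≢0) x∉L))) (trans balanced (β-vs-x b (All.head inside)))))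
  where
    open JumpSet J
    open MaximalRun run

jump-flipped : ∀ {x τ τ′} → Unique τ′ → Jump x τ τ′ → Flipped x τ τ′
jump-flipped {x} u j@(jump {L = L} {b} {bs} {R} J run) = record
  { sameEnds = record
    { ↭-original = jump-↭ j
    ; head<0     = jump-head J L b bs R (All.head inside)
    ; last>0     = proj₁ (jump-last J L b bs R inside)
    ; last<0     = proj₂ (jump-last J L b bs R inside)
    }
  ; entries  = λ k → trans (entryOf-↭ k (subst Unique (sym (letters-signatureFrom 0ℤ _)) u) (jump-signature J run))
                           (entryOf-map-flipAt x k (signature (L ++ x ∷ (b ∷ bs) ++ R)))
  }
  where open MaximalRun run

jumpSet<0 : ∀ x → ltᵇ x 0ℤ ≡ true → JumpSet x (λ y → ltᵇ y x)
jumpSet<0 x x<0 = record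
  { β-below        = true
  ; β-vs-x         = λ _ b<x → b<x
  ; outside-vs-x   = λ _ n≮x _ → n≮x
  ; x-like-β       = λ n b n≮x n≢x b<x →
      let x<n = trans (ltᵇ-flip x n (≢-sym n≢x)) (cong not n≮x)
      in trans x<n (sym (ltᵇ-trans b x n b<x x<n))
  ; outside-like-x = λ n b n≮x _ b<x →
      trans (ltᵇ-asym b x b<x)
            (sym (ltᵇ-false n b λ n<b → case trans (sym (ltᵇ-trans n b x (ltᵇ-complete n<b) b<x)) n≮x of λ ()))
  ; β-sign         = λ b b<x →
      trans (ltᵇ-asym b 0ℤ (ltᵇ-trans b x 0ℤ b<x x<0)) (sym (ltᵇ-asym x 0ℤ x<0))
  ; 0∉β            = ltᵇ-asym x 0ℤ x<0
  ; x∉β            = ltᵇ-irrefl x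
  ; x≢0            = ℤP.<⇒≢ (ltᵇ-sound x 0ℤ x<0)
  }

jumpSet>0 : ∀ x → ltᵇ 0ℤ x ≡ true → JumpSet x (λ y → ltᵇ x y)
jumpSet>0 x 0<x = record
  { β-below        = false
  ; β-vs-x         = λ b x<b → ltᵇ-asym x b x<b
  ; outside-vs-x   = λ n x≮n n≢x → trans (ltᵇ-flip n x n≢x) (cong not x≮n)
  ; x-like-β       = λ n b x≮n _ x<b →
      trans x≮n (sym (ltᵇ-false b n λ b<n → case trans (sym (ltᵇ-trans x b n x<b (ltᵇ-complete b<n))) x≮n of λ ()))
  ; outside-like-x = λ n b x≮n n≢x x<b →
      let n<x = trans (ltᵇ-flip n x n≢x) (cong not x≮n)
      in trans x<b (sym (ltᵇ-trans n x b n<x x<b))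
  ; β-sign         = λ b x<b → trans (ltᵇ-trans 0ℤ x b 0<x x<b) (sym 0<x)
  ; 0∉β            = ltᵇ-asym 0ℤ x 0<x
  ; x∉β            = ltᵇ-irrefl x
  ; x≢0            = ≢-sym (ℤP.<⇒≢ (ltᵇ-sound 0ℤ x 0<x))
  }

insR-after-run : ∀ (β : ℤ → Bool) cond x → β 0ℤ ≡ false →
  (∀ a c → β a ≡ true → c ≢ x → cond a c ≡ not (β c)) →
  ∀ a R → β a ≡ true → All (_≢ x) R →
  ∃₂ λ bs R′ → R ≡ bs ++ R′ × All (λ c → β c ≡ true) (a ∷ bs) × β (headOr0 R′) ≡ false
             × insR cond x (a ∷ R) ≡ a ∷ bs ++ x ∷ R′
insR-after-run β cond x 0∉β stop a []      a∈β _ = [] , [] , refl , a∈β ∷ [] , 0∉β , if-same (cond a 0ℤ) _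
insR-after-run β cond x 0∉β stop a (c ∷ R) a∈β (c≢x ∷ x∉R) with bool-cases (β c)
... | inj₁ c∈β =
  let (bs , R′ , R≡ , run , end , ins) = insR-after-run β cond x 0∉β stop c R c∈β x∉R
  in c ∷ bs , R′ , cong (c ∷_) R≡ , a∈β ∷ run , end
   , trans (if-false (trans (stop a c a∈β c≢x) (cong not c∈β))) (cong (a ∷_) ins)
... | inj₂ c∉β = [] , c ∷ R , refl , a∈β ∷ [] , c∉β , if-true (trans (stop a c a∈β c≢x) (cong not c∉β))

All-reverse : ∀ {P : ℤ → Set} xs → All P xs → All P (reverse xs)
All-reverse xs = PermP.All-resp-↭ (↭-sym (PermP.↭-reverse xs))

headOr0-++-∷ : ∀ ys (a : ℤ) zs zs′ → headOr0 (ys ++ a ∷ zs) ≡ headOr0 (ys ++ a ∷ zs′)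
headOr0-++-∷ []       a zs zs′ = refl
headOr0-++-∷ (b ∷ ys) a zs zs′ = refl

lastOf-reverse : ∀ p L → lastOf p L ≡ headOr0 (reverse L ++ [ p ])
lastOf-reverse p []      = refl
lastOf-reverse p (a ∷ L) = trans (lastOf-reverse a L) (trans (headOr0-++-∷ (reverse L) a [] [ p ])
  (cong headOr0 (trans (sym (ListP.++-assoc (reverse L) [ a ] [ p ])) (cong (_++ [ p ]) (sym (ListP.unfold-reverse a L))))))

lastOr0-reverse : ∀ L → lastOr0 L ≡ headOr0 (reverse L)
lastOr0-reverse L = trans (lastOr0≡lastOf L) (trans (lastOf-reverse 0ℤ L) (head-snoc0 (reverse L)))
  where
    head-snoc0 : ∀ ys → headOr0 (ys ++ [ 0ℤ ]) ≡ headOr0 ys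
    head-snoc0 []      = refl
    head-snoc0 (a ∷ _) = refl

jump-rightwards : ∀ {x β} → JumpSet x β → ∀ cond → (∀ a c → β a ≡ true → c ≢ x → cond a c ≡ not (β c)) →
  ∀ L R → All (_≢ x) L → All (_≢ x) R → β (lastOr0 L) ≡ false → β (headOr0 R) ≡ true →
  Jump x (L ++ x ∷ R) (L ++ insR cond x R)
jump-rightwards J cond stop L []      _   _ _ 0∈β with () ← trans (sym (JumpSet.0∉β J)) 0∈β
jump-rightwards {x} {β} J cond stop L (a ∷ R) x∉L (_ ∷ x∉R) l∉β a∈β
  with insR-after-run β cond x (JumpSet.0∉β J) stop a R a∈β x∉R
... | bs , R′ , refl , run , end , ins rewrite ins = jump J record
  { before = subst (λ l → β l ≡ false) (lastOr0≡lastOf L) l∉β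
  ; x∉L    = x∉L
  ; inside = run
  ; after  = end
  ; x∉R    = AllP.++⁻ʳ bs x∉R
  }

insL-before-run : ∀ (β : ℤ → Bool) cond x → β 0ℤ ≡ false →
  (∀ a c → β a ≡ true → c ≢ x → cond c a ≡ not (β c)) →
  ∀ L → β (lastOr0 L) ≡ true → All (_≢ x) L →
  ∃ λ L′ → ∃₂ λ b bs → L ≡ L′ ++ b ∷ bs × All (λ c → β c ≡ true) (b ∷ bs) × β (lastOf 0ℤ L′) ≡ false
                     × insL cond x L ≡ L′ ++ x ∷ b ∷ bs
insL-before-run β cond x 0∉β stop L l∈β x∉L with reverse L in L≡
... | [] with () ← trans (sym 0∉β) (trans (cong β (trans (cong headOr0 (sym L≡)) (sym (lastOr0-reverse L)))) l∈β)
... | a ∷ M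
  with insR-after-run β (λ b a → cond a b) x 0∉β stop a M
         (trans (cong β (trans (cong headOr0 (sym L≡)) (sym (lastOr0-reverse L)))) l∈β)
         (All.tail (subst (All (_≢ x)) L≡ (All-reverse L x∉L)))
...   | bs , R′ , refl , run , end , ins with reverse (a ∷ bs) in B≡
...     | [] with () ← trans (sym (ListP.length-reverse (a ∷ bs))) (cong List.length B≡)
...     | b ∷ bs′ = reverse R′ , b , bs′ , L-split , subst (All (λ c → β c ≡ true)) B≡ (All-reverse (a ∷ bs) run)
                  , start , ins-split
  where
    open ≡-Reasoning
    L-split : L ≡ reverse R′ ++ b ∷ bs′
    L-split = begin
      L                              ≡⟨ sym (ListP.reverse-involutive L) ⟩
      reverse (reverse L)            ≡⟨ cong reverse L≡ ⟩
      reverse ((a ∷ bs) ++ R′)       ≡⟨ ListP.reverse-++ (a ∷ bs) R′ ⟩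
      reverse R′ ++ reverse (a ∷ bs) ≡⟨ cong (reverse R′ ++_) B≡ ⟩
      reverse R′ ++ b ∷ bs′          ∎
    start : β (lastOf 0ℤ (reverse R′)) ≡ false
    start = trans (cong β (trans (sym (lastOr0≡lastOf (reverse R′)))
                  (trans (lastOr0-reverse (reverse R′)) (cong headOr0 (ListP.reverse-involutive R′))))) end
    ins-split : reverse (insR (λ b a → cond a b) x ((a ∷ bs) ++ R′)) ≡ reverse R′ ++ x ∷ b ∷ bs′
    ins-split = begin
      reverse (insR (λ b a → cond a b) x ((a ∷ bs) ++ R′)) ≡⟨ cong reverse ins ⟩
      reverse ((a ∷ bs) ++ x ∷ R′)                          ≡⟨ ListP.reverse-++ (a ∷ bs) (x ∷ R′) ⟩
      reverse (x ∷ R′) ++ reverse (a ∷ bs)                  ≡⟨ cong₂ _++_ (ListP.unfold-reverse x R′) B≡ ⟩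
      (reverse R′ ++ [ x ]) ++ b ∷ bs′                      ≡⟨ ListP.++-assoc (reverse R′) [ x ] (b ∷ bs′) ⟩
      reverse R′ ++ x ∷ b ∷ bs′                             ∎

jump-leftwards : ∀ {x β} → JumpSet x β → ∀ cond → (∀ a c → β a ≡ true → c ≢ x → cond c a ≡ not (β c)) →
  ∀ L R → All (_≢ x) L → All (_≢ x) R → β (lastOr0 L) ≡ true → β (headOr0 R) ≡ false →
  Jump x (insL cond x L ++ R) (L ++ x ∷ R)
jump-leftwards {x} {β} J cond stop L R x∉L x∉R l∈β r∉β
  with insL-before-run β cond x (JumpSet.0∉β J) stop L l∈β x∉L
... | L′ , b , bs , refl , run , start , ins rewrite ins =
  subst₂ (Jump x) (sym (ListP.++-assoc L′ (x ∷ b ∷ bs) R)) (sym (ListP.++-assoc L′ (b ∷ bs) (x ∷ R))) (jump J record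
    { before = start
    ; x∉L    = AllP.++⁻ˡ L′ x∉L
    ; inside = run
    ; after  = r∉β
    ; x∉R    = x∉R
    })

splitAt-just : ∀ x τ {L R} → splitAt x τ ≡ just (L , R) → τ ≡ L ++ x ∷ R × All (_≢ x) L
splitAt-just x []      ()
splitAt-just x (a ∷ τ) eq with a ℤP.≟ x
splitAt-just x (a ∷ τ) refl | yes refl = refl , []
... | no a≢x with splitAt x τ in eq′
splitAt-just x (a ∷ τ) refl | no a≢x | just _ =
  let τ≡ , x∉L = splitAt-just x τ eq′ in cong (a ∷_) τ≡ , a≢x ∷ x∉L

splitAt-nothing : ∀ x τ → splitAt x τ ≡ nothing → All (_≢ x) τ
splitAt-nothing x []      _  = []
splitAt-nothing x (a ∷ τ) eq with a ℤP.≟ x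
splitAt-nothing x (a ∷ τ) () | yes refl
... | no a≢x with splitAt x τ in eq′
... | nothing = a≢x ∷ splitAt-nothing x τ eq′
splitAt-nothing x (a ∷ τ) () | no a≢x | just _

unique-∉-after : ∀ {x : ℤ} L {R} → Unique (L ++ x ∷ R) → All (_≢ x) R
unique-∉-after []      (x∉R ∷ _) = All.map ≢-sym x∉R
unique-∉-after (a ∷ L) (_ ∷ u)   = unique-∉-after L u

-- The body of ψ from Defs, for τ already split as L ++ x ∷ R.
ψ-at : ℤ → List ℤ → List ℤ → List ℤ → List ℤ
ψ-at x π L R =
  let l = lastOr0 L ; r = headOr0 R in
  if ltᵇ x 0ℤ
  then (if between r x l then L ++ insR (λ a b → between a x b) x R
        else if between l x r then insL (λ a b → between b x a) x L ++ R
        else π)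
  else if ltᵇ 0ℤ x
  then (if between r x l then insL (λ a b → between a x b) x L ++ R
        else if between l x r then L ++ insR (λ a b → between b x a) x R
        else π)
  else π

ψ-split : ∀ x τ L R → splitAt x τ ≡ just (L , R) → ψ x τ ≡ ψ-at x τ L R
ψ-split x τ L R eq with splitAt x τ
ψ-split x τ L R refl | just _ = refl

ψ-absent : ∀ x τ → splitAt x τ ≡ nothing → ψ x τ ≡ τ
ψ-absent x τ eq with splitAt x τ
ψ-absent x τ refl | nothing = refl

between-from-below : ∀ x a c → ltᵇ a x ≡ true → c ≢ x → between a x c ≡ not (ltᵇ c x)
between-from-below x a c a<x c≢x rewrite a<x = ltᵇ-flip x c (≢-sym c≢x)

between-from-above : ∀ x a c → ltᵇ x a ≡ true → c ≢ x → between c x a ≡ not (ltᵇ x c)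
between-from-above x a c x<a c≢x rewrite x<a = trans (∧-identityʳ _) (ltᵇ-flip c x c≢x)

neither-between : ∀ l r x → l ≢ x → r ≢ x → between r x l ≡ false → between l x r ≡ false →
                  ltᵇ l x ≡ ltᵇ r x
neither-between l r x l≢x r≢x rxl lxr with compare≢ l x l≢x | compare≢ r x r≢x
... | less l<x _    | less r<x _    = trans l<x (sym r<x)
... | less l<x _    | greater _ x<r with () ← trans (sym lxr) (cong₂ _∧_ l<x x<r)
... | greater _ x<l | less r<x _    with () ← trans (sym rxl) (cong₂ _∧_ r<x x<l)
... | greater l≮x _ | greater r≮x _ = trans l≮x (sym r≮x)

data ψ-View (x : ℤ) (τ : List ℤ) : Set where
  stays       : ψ x τ ≡ τ → Balanced (entryOf x (signature τ)) → ψ-View x τ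
  jumps-right : Jump x τ (ψ x τ) → ψ-View x τ
  jumps-left  : Jump x (ψ x τ) τ → ψ-View x τ

ψ-view-split : ∀ x L R → x ≢ 0ℤ → All (_≢ x) L → All (_≢ x) R →
               ψ x (L ++ x ∷ R) ≡ ψ-at x (L ++ x ∷ R) L R → ψ-View x (L ++ x ∷ R)
ψ-view-split x L R x≢0 x∉L x∉R ψ≡
  with compare≢ x 0ℤ x≢0 | bool-cases (between (headOr0 R) x (lastOr0 L)) | bool-cases (between (lastOr0 L) x (headOr0 R))
... | less x<0 _ | inj₁ r<x<l | _ =
  let r<x , x<l = ∧-true r<x<l in
  jumps-right (subst (Jump x _) (sym (trans ψ≡ (trans (if-true x<0) (if-true r<x<l))))
    (jump-rightwards (jumpSet<0 x x<0) _ (between-from-below x) L R x∉L x∉R (ltᵇ-asym x _ x<l) r<x))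
... | greater _ 0<x | inj₁ r<x<l | _ =
  let r<x , x<l = ∧-true r<x<l in
  jumps-left (subst (λ τ → Jump x τ (L ++ x ∷ R)) (sym (trans ψ≡ (trans (if-false x≮0) (trans (if-true 0<x) (if-true r<x<l)))))
    (jump-leftwards (jumpSet>0 x 0<x) _ (between-from-above x) L R x∉L x∉R x<l (ltᵇ-asym _ x r<x)))
  where x≮0 = ltᵇ-asym 0ℤ x 0<x
... | less x<0 _ | inj₂ rxl | inj₁ l<x<r =
  let l<x , x<r = ∧-true l<x<r in
  jumps-left (subst (λ τ → Jump x τ (L ++ x ∷ R)) (sym (trans ψ≡ (trans (if-true x<0) (trans (if-false rxl) (if-true l<x<r)))))
    (jump-leftwards (jumpSet<0 x x<0) _ (between-from-below x) L R x∉L x∉R l<x (ltᵇ-asym x _ x<r)))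
... | greater x≮0 0<x | inj₂ rxl | inj₁ l<x<r =
  let l<x , x<r = ∧-true l<x<r in
  jumps-right (subst (Jump x _) (sym (trans ψ≡ (trans (if-false x≮0) (trans (if-true 0<x) (trans (if-false rxl) (if-true l<x<r))))))
    (jump-rightwards (jumpSet>0 x 0<x) _ (between-from-above x) L R x∉L x∉R (ltᵇ-asym _ x l<x) x<r))
... | sign | inj₂ rxl | inj₂ lxr = stays (trans ψ≡ (unmoved sign)) balanced
  where
    unmoved : Compare≢ x 0ℤ → ψ-at x (L ++ x ∷ R) L R ≡ L ++ x ∷ R
    unmoved (less x<0 _)      rewrite x<0 | rxl | lxr = refl
    unmoved (greater x≮0 0<x) rewrite x≮0 | 0<x | rxl | lxr = refl
    balanced : Balanced (entryOf x (signature (L ++ x ∷ R)))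
    balanced rewrite entryOf-signature x L R x∉L = subst (λ l → ltᵇ l x ≡ ltᵇ (headOr0 R) x) (lastOr0≡lastOf L)
      (neither-between (lastOr0 L) (headOr0 R) x
        (subst (_≢ x) (sym (lastOr0≡lastOf L)) (lastOf-∉ 0ℤ L (≢-sym x≢0) x∉L))
        (headOr0-∉ R (≢-sym x≢0) x∉R) rxl lxr)

ψ-view : ∀ x τ → x ≢ 0ℤ → Unique τ → ψ-View x τ
ψ-view x τ x≢0 u with splitAt x τ in eq
... | nothing = stays (ψ-absent x τ eq) (subst Balanced (sym (entryOf-∉ x (signature τ)
                  (subst (All (_≢ x)) (sym (letters-signatureFrom 0ℤ τ)) (splitAt-nothing x τ eq)))) refl)
... | just (L , R) with splitAt-just x τ eq
...   | refl , x∉L = ψ-view-split x L R x≢0 x∉L (unique-∉-after L u) (ψ-split x τ L R eq)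

flipped-refl : ∀ {x τ} → Balanced (entryOf x (signature τ)) → Flipped x τ τ
flipped-refl {x} {τ} balanced = record
  { sameEnds = sameEnds-refl ; entries = unflipped }
  where
    unflipped : ∀ k → entryOf k (signature τ) ≡ flipAt x (entryOf k (signature τ))
    unflipped k with k ℤP.≟ x
    ... | yes refl = sym (flipAt-balanced k _ balanced)
    ... | no k≢x   = sym (flipAt-≢ x _ (λ e → k≢x (trans (sym (entryOf-letter k (signature τ))) e)))

ψ-flipped : ∀ x τ → x ≢ 0ℤ → Unique τ → Flipped x τ (ψ x τ)
ψ-flipped x τ x≢0 u with ψ-view x τ x≢0 u
... | stays ψ≡ balanced = subst (Flipped x τ) (sym ψ≡) (flipped-refl balanced)
... | jumps-right j     = jump-flipped (unique-resp-↭ u (↭-sym (jump-↭ j))) j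
... | jumps-left j      = flipped-sym (jump-flipped u j)

ψ-balanced-fixed : ∀ x τ → x ≢ 0ℤ → Unique τ → Balanced (entryOf x (signature τ)) → ψ x τ ≡ τ
ψ-balanced-fixed x τ x≢0 u balanced with ψ-view x τ x≢0 u
... | stays ψ≡ _   = ψ≡
... | jumps-right j = ⊥-elim (jump-unbalanced j balanced)
... | jumps-left j  = ⊥-elim (jump-unbalanced j (balanced-flipAt x (entryOf x (signature (ψ x τ)))
                        (subst Balanced (Flipped.entries (jump-flipped u j) x) balanced)))

-- Composing moves

flipIf : Bool → Entry → Entry
flipIf true  (a , l , n) = (a , n , l)
flipIf false e           = e

flipIf-xor : ∀ a b e → flipIf a (flipIf b e) ≡ flipIf (a xor b) e
flipIf-xor false b     e           = refl
flipIf-xor true  false e           = refl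
flipIf-xor true  true  (x , l , n) = refl

flipIf-letter : ∀ b e → proj₁ (flipIf b e) ≡ proj₁ e
flipIf-letter false e = refl
flipIf-letter true  e = refl

flipIf-balanced : ∀ b e → Balanced e → Balanced (flipIf b e)
flipIf-balanced false e           balanced = balanced
flipIf-balanced true  (a , l , .l) refl    = refl

isMovable : Entry → Bool
isMovable (_ , l , n) = l xor n

unmovable-balanced : ∀ e → isMovable e ≡ false → Balanced e
unmovable-balanced (a , false , false) _ = refl
unmovable-balanced (a , true  , true)  _ = refl

module Action {p : ℕ} (P : LabeledPoset p) (ω≢0 : ∀ y → LabeledPoset.ω P y ≢ 0ℤ)
              (π : List ℤ) (π-unique : Unique π) where
  open LabeledPoset P using (ω; ω-injective)

  -- ψS P S π unfolds to ψ-over S (allFin p).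
  ψ-over : Subset p → List (Fin p) → List ℤ
  ψ-over S xs = foldr (λ x acc → if lookup S x then ψ (ω x) acc else acc) π xs

  entry : Fin p → Entry
  entry y = entryOf (ω y) (signature π)

  flips : Subset p → List (Fin p) → Fin p → Bool
  flips S []       y = false
  flips S (z ∷ xs) y = (lookup S z ∧ does (z Fin.≟ y)) xor flips S xs y

  ψ-over-sameEnds : ∀ S xs → SameEnds π (ψ-over S xs)
  ψ-over-sameEnds S []       = sameEnds-refl
  ψ-over-sameEnds S (z ∷ xs) with lookup S z
  ... | false = ψ-over-sameEnds S xs
  ... | true  = sameEnds-trans E (Flipped.sameEnds (ψ-flipped (ω z) _ (ω≢0 z)
                  (unique-resp-↭ π-unique (↭-sym (SameEnds.↭-original E)))))
    where E = ψ-over-sameEnds S xs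

  ψ-over-unique : ∀ S xs → Unique (ψ-over S xs)
  ψ-over-unique S xs = unique-resp-↭ π-unique (↭-sym (SameEnds.↭-original (ψ-over-sameEnds S xs)))

  flipAt-ω : ∀ z y e → proj₁ e ≡ ω y → flipAt (ω z) e ≡ flipIf (does (z Fin.≟ y)) e
  flipAt-ω z y (a , l , n) refl with z Fin.≟ y
  ... | yes refl = flipAt-≡ (ω z) l n
  ... | no z≢y   = flipAt-≢ (ω z) (ω y , l , n) (λ e → z≢y (sym (ω-injective e)))

  ψ-over-entries : ∀ S xs y → entryOf (ω y) (signature (ψ-over S xs)) ≡ flipIf (flips S xs y) (entry y)
  ψ-over-entries S []       y = refl
  ψ-over-entries S (z ∷ xs) y with lookup S z
  ... | false = ψ-over-entries S xs y
  ... | true  = begin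
    entryOf (ω y) (signature (ψ (ω z) (ψ-over S xs)))
      ≡⟨ Flipped.entries (ψ-flipped (ω z) _ (ω≢0 z) (ψ-over-unique S xs)) (ω y) ⟩
    flipAt (ω z) (entryOf (ω y) (signature (ψ-over S xs)))
      ≡⟨ cong (flipAt (ω z)) (ψ-over-entries S xs y) ⟩
    flipAt (ω z) (flipIf (flips S xs y) (entry y))
      ≡⟨ flipAt-ω z y _ (trans (flipIf-letter (flips S xs y) (entry y)) (entryOf-letter (ω y) (signature π))) ⟩
    flipIf (does (z Fin.≟ y)) (flipIf (flips S xs y) (entry y))
      ≡⟨ flipIf-xor (does (z Fin.≟ y)) (flips S xs y) (entry y) ⟩
    flipIf (does (z Fin.≟ y) xor flips S xs y) (entry y) ∎
    where open ≡-Reasoning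

  flips-∉ : ∀ S xs y → All (_≢ y) xs → flips S xs y ≡ false
  flips-∉ S []       y _           = refl
  flips-∉ S (z ∷ xs) y (z≢y ∷ y∉) rewrite dec-false (z Fin.≟ y) z≢y | ∧-zeroʳ (lookup S z) = flips-∉ S xs y y∉

  flips-∈ : ∀ S xs y → Unique xs → y ∈ xs → flips S xs y ≡ lookup S y
  flips-∈ S (z ∷ xs) y (z∉ ∷ u) (here refl)
    rewrite dec-true (z Fin.≟ z) refl | ∧-identityʳ (lookup S z) | flips-∉ S xs z (All.map ≢-sym z∉)
    = xor-identityʳ (lookup S z)
  flips-∈ S (z ∷ xs) y (z∉ ∷ u) (there y∈)
    rewrite dec-false (z Fin.≟ y) (All.lookup z∉ y∈) | ∧-zeroʳ (lookup S z) = flips-∈ S xs y u y∈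

  entryOf-ψS : ∀ S y → entryOf (ω y) (signature (ψS P S π)) ≡ flipIf (lookup S y) (entry y)
  entryOf-ψS S y = trans (ψ-over-entries S (allFin p) y)
    (cong (λ b → flipIf b (entry y)) (flips-∈ S (allFin p) y (UniqueP.allFin⁺ p) (∈-allFin y)))

  ψ-over-movable : ∀ S S′ xs → (∀ y → isMovable (entry y) ≡ true → lookup S y ≡ lookup S′ y) →
                   ψ-over S xs ≡ ψ-over S′ xs
  ψ-over-movable S S′ []       agree = refl
  ψ-over-movable S S′ (z ∷ xs) agree with isMovable (entry z) in movable
  ... | true rewrite agree z movable | ψ-over-movable S S′ xs agree = refl
  ... | false = trans (skip S) (trans (ψ-over-movable S S′ xs agree) (sym (skip S′)))
    where
      skip : ∀ T → (if lookup T z then ψ (ω z) (ψ-over T xs) else ψ-over T xs) ≡ ψ-over T xs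
      skip T with lookup T z
      ... | false = refl
      ... | true  = ψ-balanced-fixed (ω z) _ (ω≢0 z) (ψ-over-unique T xs)
          (subst Balanced (sym (ψ-over-entries T xs z))
            (flipIf-balanced (flips T xs z) (entry z) (unmovable-balanced (entry z) movable)))

-- Statistics read off the marks

indicator : Bool → ℕ
indicator b = if b then 1 else 0

count : ∀ {A : Set} → (A → Bool) → List A → ℕ
count Q E = sum (map (indicator ∘ Q) E)

descends isPeak isValley isDoubleDescent : Entry → Bool
descends        (_ , l , n) = n
isPeak          (_ , l , n) = l ∧ n
isValley        (_ , l , n) = not l ∧ not n
isDoubleDescent (_ , l , n) = not l ∧ n

peak-valley-movable : ∀ e → indicator (isPeak e) ℕ.+ indicator (isValley e) ℕ.+ indicator (isMovable e) ≡ 1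
peak-valley-movable (_ , true  , true)  = refl
peak-valley-movable (_ , true  , false) = refl
peak-valley-movable (_ , false , true)  = refl
peak-valley-movable (_ , false , false) = refl

∑-const-1 : ∀ n → ∑[ y < n ] 1 ≡ n
∑-const-1 zero    = refl
∑-const-1 (suc n) = cong suc (∑-const-1 n)

count-↭ : ∀ {A : Set} (Q : A → Bool) {E E′} → E ↭ E′ → count Q E ≡ count Q E′
count-↭ Q p = sum-↭ (PermP.map⁺ (indicator ∘ Q) p)

count-tabulate : ∀ Q {n} (h : Fin n → Entry) → count Q (List.tabulate h) ≡ ∑[ y < n ] indicator (Q (h y))
count-tabulate Q {zero}  h = refl
count-tabulate Q {suc n} h = cong (indicator (Q (h Fin.zero)) ℕ.+_) (count-tabulate Q (h ∘ Fin.suc))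

map-entryOf-letters : ∀ E → Unique (map proj₁ E) → map (λ k → entryOf k E) (map proj₁ E) ≡ E
map-entryOf-letters []                _         = refl
map-entryOf-letters ((a , l , n) ∷ E) (a∉ ∷ u) rewrite dec-true (a ℤP.≟ a) refl =
  cong ((a , l , n) ∷_) (trans (ListP.map-cong-local (skip (map proj₁ E) a∉)) (map-entryOf-letters E u))
  where
    skip : ∀ ks → All (a ≢_) ks → All (λ k → entryOf k ((a , l , n) ∷ E) ≡ entryOf k E) ks
    skip []       []           = []
    skip (k ∷ ks) (a≢k ∷ a∉ks) = if-false (dec-false (a ℤP.≟ k) a≢k) ∷ skip ks a∉ks

count-by-letters : ∀ Q {p} (ω : Fin p → ℤ) E → Unique (map proj₁ E) → map proj₁ E ↭ map ω (allFin p) →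
                   count Q E ≡ ∑[ y < p ] indicator (Q (entryOf (ω y) E))
count-by-letters Q {p} ω E u letters = begin
  count Q E                                            ≡⟨ cong (count Q) (sym (map-entryOf-letters E u)) ⟩
  count Q (map (λ k → entryOf k E) (map proj₁ E))      ≡⟨ count-↭ Q (PermP.map⁺ (λ k → entryOf k E) letters) ⟩
  count Q (map (λ k → entryOf k E) (map ω (allFin p))) ≡⟨ cong (count Q) (sym (ListP.map-∘ (allFin p))) ⟩
  count Q (map (λ y → entryOf (ω y) E) (allFin p))     ≡⟨ cong (count Q) (ListP.map-tabulate id (λ y → entryOf (ω y) E)) ⟩
  count Q (List.tabulate (λ y → entryOf (ω y) E))      ≡⟨ count-tabulate Q (λ y → entryOf (ω y) E) ⟩
  ∑[ y < p ] indicator (Q (entryOf (ω y) E))           ∎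
  where open ≡-Reasoning

des-signature : ∀ q τ → des τ ℕ.+ indicator (ltᵇ 0ℤ (lastOr0 τ)) ≡ count descends (signatureFrom q τ)
des-signature q []             = refl
des-signature q (a ∷ [])       = sym (ℕP.+-identityʳ _)
des-signature q (a ∷ b ∷ rest) =
  trans (ℕP.+-assoc (indicator (ltᵇ b a)) (des (b ∷ rest)) _) (cong (indicator (ltᵇ b a) ℕ.+_) (des-signature a (b ∷ rest)))

countDD-signature : ∀ q τ → Unique (q ∷ τ) → countDD (q ∷ τ ++ [ 0ℤ ]) ≡ count isDoubleDescent (signatureFrom q τ)
countDD-signature q []             _                = refl
countDD-signature q (a ∷ [])       ((q≢a ∷ _) ∷ _) rewrite ltᵇ-flip a q (≢-sym q≢a) = refl
countDD-signature q (a ∷ b ∷ rest) ((q≢a ∷ _) ∷ u) rewrite ltᵇ-flip a q (≢-sym q≢a) =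
  cong (indicator (not (ltᵇ q a) ∧ ltᵇ b a) ℕ.+_) (countDD-signature a (b ∷ rest) u)

peak-signature : ∀ q a rest → ltᵇ 0ℤ (lastOr0 (a ∷ rest)) ≡ false →
  count isPeak (signatureFrom q (a ∷ rest)) ≡ indicator (ltᵇ q a ∧ ltᵇ (headOr0 rest) a) ℕ.+ peak (a ∷ rest)
peak-signature q a []           _      = refl
peak-signature q a (b ∷ [])     last≤0 rewrite last≤0 | ∧-zeroʳ (ltᵇ a b) = refl
peak-signature q a (b ∷ c ∷ rest) last≤0 =
  cong (indicator (ltᵇ q a ∧ ltᵇ b a) ℕ.+_) (peak-signature a b (c ∷ rest) last≤0)

-- In q τ 0 (distinct letters, 0 ∉ τ) the interior peaks and valleys alternate.
peaks-valleys : ∀ q a rest → Unique (q ∷ a ∷ rest) → All (_≢ 0ℤ) (a ∷ rest) →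
    count isPeak (signatureFrom q (a ∷ rest)) ℕ.+ indicator (ltᵇ (lastOr0 (a ∷ rest)) 0ℤ)
  ≡ count isValley (signatureFrom q (a ∷ rest)) ℕ.+ indicator (ltᵇ q a)
peaks-valleys q a [] _ (a≢0 ∷ []) with compare≢ a 0ℤ a≢0 | ltᵇ q a
... | less    a<0 0≮a | true  rewrite a<0 | 0≮a = refl
... | less    a<0 0≮a | false rewrite a<0 | 0≮a = refl
... | greater a≮0 0<a | true  rewrite a≮0 | 0<a = refl
... | greater a≮0 0<a | false rewrite a≮0 | 0<a = refl
peaks-valleys q a (b ∷ rest) (_ ∷ u@((a≢b ∷ _) ∷ _)) (_ ∷ ≢0) =
  step (ltᵇ q a) (ltᵇ b a) _ _ _
    (trans (peaks-valleys a b rest u ≢0)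
           (cong (λ z → count isValley (signatureFrom a (b ∷ rest)) ℕ.+ indicator z) (ltᵇ-flip a b a≢b)))
  where
    step : ∀ u v A B L → A ℕ.+ L ≡ B ℕ.+ indicator (not v) →
           (indicator (u ∧ v) ℕ.+ A) ℕ.+ L ≡ (indicator (not u ∧ not v) ℕ.+ B) ℕ.+ indicator u
    step true  true  A B L h = trans (cong suc h) (sym (ℕP.+-suc B 0))
    step true  false A B L h = h
    step false true  A B L h = h
    step false false A B L h = trans h (ℕP.+-suc B 0)

-- Sums over subsets

_⊆ᵇ_ : ∀ {n} → Subset n → Subset n → Set
S ⊆ᵇ F = ∀ x → lookup S x ≡ true → lookup F x ≡ true

subsetsOf : ∀ {n} → Subset n → List (Subset n)
subsetsOf []          = [] ∷ []
subsetsOf (true ∷ F)  = map (true ∷_) (subsetsOf F) ++ map (false ∷_) (subsetsOf F)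
subsetsOf (false ∷ F) = map (false ∷_) (subsetsOf F)

∈-subsetsOf⁺ : ∀ {n} (F S : Subset n) → S ⊆ᵇ F → S ∈ subsetsOf F
∈-subsetsOf⁺ []          []          _   = here refl
∈-subsetsOf⁺ (true ∷ F)  (true ∷ S)  S⊆F = ∈-++⁺ˡ (∈-map⁺ (true ∷_) (∈-subsetsOf⁺ F S (S⊆F ∘ Fin.suc)))
∈-subsetsOf⁺ (true ∷ F)  (false ∷ S) S⊆F =
  ∈-++⁺ʳ (map (true ∷_) (subsetsOf F)) (∈-map⁺ (false ∷_) (∈-subsetsOf⁺ F S (S⊆F ∘ Fin.suc)))
∈-subsetsOf⁺ (false ∷ F) (true ∷ S)  S⊆F with () ← S⊆F Fin.zero refl
∈-subsetsOf⁺ (false ∷ F) (false ∷ S) S⊆F = ∈-map⁺ (false ∷_) (∈-subsetsOf⁺ F S (S⊆F ∘ Fin.suc))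

∈-subsetsOf⁻ : ∀ {n} (F S : Subset n) → S ∈ subsetsOf F → S ⊆ᵇ F
∈-subsetsOf⁻ (true ∷ F) S S∈ with ∈-++⁻ (map (true ∷_) (subsetsOf F)) S∈
... | inj₁ S∈₁ with ∈-map⁻ (true ∷_) S∈₁
...   | S′ , S′∈ , refl = λ { Fin.zero _ → refl ; (Fin.suc x) → ∈-subsetsOf⁻ F S′ S′∈ x }
∈-subsetsOf⁻ (true ∷ F) S S∈ | inj₂ S∈₂ with ∈-map⁻ (false ∷_) S∈₂
...   | S′ , S′∈ , refl = λ { Fin.zero () ; (Fin.suc x) → ∈-subsetsOf⁻ F S′ S′∈ x }
∈-subsetsOf⁻ (false ∷ F) S S∈ with ∈-map⁻ (false ∷_) S∈
... | S′ , S′∈ , refl = λ { Fin.zero () ; (Fin.suc x) → ∈-subsetsOf⁻ F S′ S′∈ x }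

subsetsOf-unique : ∀ {n} (F : Subset n) → Unique (subsetsOf F)
subsetsOf-unique []          = [] ∷ []
subsetsOf-unique (true ∷ F)  =
  UniqueP.++⁺ (UniqueP.map⁺ VecP.∷-injectiveʳ (subsetsOf-unique F))
              (UniqueP.map⁺ VecP.∷-injectiveʳ (subsetsOf-unique F)) disjoint
  where
    disjoint : ∀ {S} → ¬ (S ∈ map (true ∷_) (subsetsOf F) × S ∈ map (false ∷_) (subsetsOf F))
    disjoint (S∈₁ , S∈₂) with ∈-map⁻ (true ∷_) S∈₁ | ∈-map⁻ (false ∷_) S∈₂
    ... | _ , _ , refl | _ , _ , ()
subsetsOf-unique (false ∷ F) = UniqueP.map⁺ VecP.∷-injectiveʳ (subsetsOf-unique F)

∈-allSubsets : ∀ n (S : Subset n) → S ∈ allSubsets n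
∈-allSubsets zero    []          = here refl
∈-allSubsets (suc n) (true ∷ S)  = ∈-++⁺ˡ (∈-map⁺ (true ∷_) (∈-allSubsets n S))
∈-allSubsets (suc n) (false ∷ S) = ∈-++⁺ʳ (map (true ∷_) (allSubsets n)) (∈-map⁺ (false ∷_) (∈-allSubsets n S))

lookup-extensionality : ∀ {n} (S S′ : Subset n) → (∀ x → lookup S x ≡ lookup S′ x) → S ≡ S′
lookup-extensionality S S′ eq = trans (sym (VecP.tabulate∘lookup S)) (trans (VecP.tabulate-cong eq) (VecP.tabulate∘lookup S′))

map-unique-injectiveOn : ∀ {A B : Set} (f : A → B) (L : List A) → Unique L →
  (∀ {a b} → a ∈ L → b ∈ L → f a ≡ f b → a ≡ b) → Unique (map f L)
map-unique-injectiveOn f []      _         _   = []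
map-unique-injectiveOn f (a ∷ L) (a∉ ∷ u) inj =
  AllP.map⁺ (All.tabulate λ {b} b∈ fa≡fb → All.lookup a∉ b∈ (inj (here refl) (there b∈) fa≡fb))
  ∷ map-unique-injectiveOn f L u (λ a∈ b∈ → inj (there a∈) (there b∈))

sumℤ : List ℤ → ℤ
sumℤ = foldr _+_ 0ℤ

sumℤ-++ : ∀ xs ys → sumℤ (xs ++ ys) ≡ sumℤ xs + sumℤ ys
sumℤ-++ []       ys = sym (ℤP.+-identityˡ (sumℤ ys))
sumℤ-++ (x ∷ xs) ys = trans (cong (λ s → x + s) (sumℤ-++ xs ys)) (sym (ℤP.+-assoc x (sumℤ xs) (sumℤ ys)))

sumℤ-*ˡ : ∀ {A : Set} c (f : A → ℤ) L → sumℤ (map (λ a → c * f a) L) ≡ c * sumℤ (map f L)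
sumℤ-*ˡ c f []      = sym (ℤP.*-zeroʳ c)
sumℤ-*ˡ c f (a ∷ L) = trans (cong (λ s → c * f a + s) (sumℤ-*ˡ c f L)) (sym (ℤP.*-distribˡ-+ c (f a) (sumℤ (map f L))))

sumℤ-↭ : ∀ {xs ys} → xs ↭ ys → sumℤ xs ≡ sumℤ ys
sumℤ-↭ p = PermS.foldr-commMonoid (setoid ℤ) ℤP.+-0-isCommutativeMonoid (↭⇒↭ₛ p)

-- Each coordinate in F contributes a factor t ^ w x false + t ^ w x true = 1 + t, each coordinate
-- outside F a factor t ^ w x false = 1.
sum-over-subsets : ∀ {n} (F : Subset n) (w : Fin n → Bool → ℕ) t →
  (∀ x → lookup F x ≡ true → t ^ w x false + t ^ w x true ≡ 1ℤ + t) →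
  (∀ x → lookup F x ≡ false → w x false ≡ 0) →
  sumℤ (map (λ S → t ^ ∑[ x < n ] w x (lookup S x)) (subsetsOf F)) ≡ (1ℤ + t) ^ ∑[ x < n ] indicator (lookup F x)
sum-over-subsets []               w t _    _   = refl
sum-over-subsets {suc n} (f ∷ F) w t in-F out-F = coordinate f in-F out-F
  where
    w′ = λ x → w (Fin.suc x)
    G = λ S → t ^ ∑[ x < suc n ] w x (lookup S x)
    rest = sumℤ (map (λ S → t ^ ∑[ x < n ] w′ x (lookup S x)) (subsetsOf F))
    IH : rest ≡ (1ℤ + t) ^ ∑[ x < n ] indicator (lookup F x)
    IH = sum-over-subsets F w′ t (in-F ∘ Fin.suc) (out-F ∘ Fin.suc)
    with-first : ∀ b → sumℤ (map G (map (b ∷_) (subsetsOf F)))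
                       ≡ t ^ w Fin.zero b * rest
    with-first b = trans (cong sumℤ (trans (sym (ListP.map-∘ (subsetsOf F)))
                     (ListP.map-cong (λ S → ℤP.^-distribˡ-+-* t (w Fin.zero b) _) (subsetsOf F))))
                   (sumℤ-*ˡ (t ^ w Fin.zero b) (λ S → t ^ ∑[ x < n ] w′ x (lookup S x)) (subsetsOf F))
    coordinate : ∀ f → (∀ x → lookup (f ∷ F) x ≡ true → t ^ w x false + t ^ w x true ≡ 1ℤ + t) →
      (∀ x → lookup (f ∷ F) x ≡ false → w x false ≡ 0) →
      sumℤ (map G (subsetsOf (f ∷ F)))
        ≡ (1ℤ + t) ^ ∑[ x < suc n ] indicator (lookup (f ∷ F) x)
    coordinate true in-F out-F = begin
      sumℤ (map G (map (true ∷_) (subsetsOf F) ++ map (false ∷_) (subsetsOf F)))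
        ≡⟨ trans (cong sumℤ (ListP.map-++ G (map (true ∷_) (subsetsOf F)) _))
                 (sumℤ-++ (map G (map (true ∷_) (subsetsOf F))) _) ⟩
      sumℤ (map G (map (true ∷_) (subsetsOf F))) + sumℤ (map G (map (false ∷_) (subsetsOf F)))
        ≡⟨ cong₂ _+_ (with-first true) (with-first false) ⟩
      t ^ w Fin.zero true * rest + t ^ w Fin.zero false * rest
        ≡⟨ sym (ℤP.*-distribʳ-+ rest (t ^ w Fin.zero true) _) ⟩
      (t ^ w Fin.zero true + t ^ w Fin.zero false) * rest
        ≡⟨ cong₂ _*_ (trans (ℤP.+-comm (t ^ w Fin.zero true) _) (in-F Fin.zero refl)) IH ⟩
      (1ℤ + t) * (1ℤ + t) ^ ∑[ x < n ] indicator (lookup F x) ∎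
      where open ≡-Reasoning
    coordinate false in-F out-F = begin
      sumℤ (map G (map (false ∷_) (subsetsOf F)))      ≡⟨ with-first false ⟩
      t ^ w Fin.zero false * rest                        ≡⟨ cong₂ (λ k r → t ^ k * r) (out-F Fin.zero refl) IH ⟩
      1ℤ * (1ℤ + t) ^ ∑[ x < n ] indicator (lookup F x) ≡⟨ ℤP.*-identityˡ _ ⟩
      (1ℤ + t) ^ ∑[ x < n ] indicator (lookup F x)     ∎
      where open ≡-Reasoning

-- Saturated chains and canonical labelings

indicator-mono : ∀ a b → (a ≡ true → b ≡ true) → indicator a ℕ.≤ indicator b
indicator-mono false b _   = ℕ.z≤n
indicator-mono true  b a⇒b rewrite a⇒b refl = ℕP.≤-refl

count-mono : ∀ {A : Set} (f g : A → Bool) → (∀ w → f w ≡ true → g w ≡ true) → ∀ L → count f L ℕ.≤ count g L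
count-mono f g f⇒g []      = ℕ.z≤n
count-mono f g f⇒g (w ∷ L) = ℕP.+-mono-≤ (indicator-mono (f w) (g w) (f⇒g w)) (count-mono f g f⇒g L)

count-mono-< : ∀ {A : Set} (f g : A → Bool) → (∀ w → f w ≡ true → g w ≡ true) →
               ∀ {c} → f c ≡ false → g c ≡ true → ∀ {L} → c ∈ L → count f L ℕ.< count g L
count-mono-< f g f⇒g fc gc {w ∷ L} (here refl) rewrite fc | gc = ℕ.s≤s (count-mono f g f⇒g L)
count-mono-< f g f⇒g fc gc {w ∷ L} (there c∈) =
  ℕP.+-mono-≤-< (indicator-mono (f w) (g w) (f⇒g w)) (count-mono-< f g f⇒g fc gc c∈)

¬¬-∀-Fin : ∀ {n} {R : Fin n → Set} → (∀ i → ¬ ¬ R i) → ¬ ¬ (∀ i → R i)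
¬¬-∀-Fin {zero}      _   k = k λ ()
¬¬-∀-Fin {suc n} {R} ¬¬R k = ¬¬R Fin.zero λ R₀ → ¬¬-∀-Fin {n} {R ∘ Fin.suc} (¬¬R ∘ Fin.suc)
  λ R₊ → k λ { Fin.zero → R₀ ; (Fin.suc i) → R₊ i }

module Chains {p : ℕ} (P : LabeledPoset p) where
  open LabeledPoset P
  open IsPartialOrder isPartialOrder using (antisym) renaming (trans to ≤-trans)

  <P-irrefl : ∀ {a} → ¬ (a <P a)
  <P-irrefl (_ , a≢a) = a≢a refl

  <-≤P-trans : ∀ {a b c} → a <P b → b ≤P c → a <P c
  <-≤P-trans (a≤b , a≢b) b≤c = ≤-trans a≤b b≤c , λ { refl → a≢b (antisym a≤b b≤c) }

  ≤-<P-trans : ∀ {a b c} → a ≤P b → b <P c → a <P c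
  ≤-<P-trans a≤b (b≤c , b≢c) = ≤-trans a≤b b≤c , λ { refl → b≢c (antisym b≤c a≤b) }

  extend : ∀ {a b c} → SatChain a b → b ⋖ c → SatChain a c
  extend (single b)    b⋖c = step b⋖c (single _)
  extend (step a⋖ ch) b⋖c = step a⋖ (extend ch b⋖c)

  module _ (_<?_ : ∀ a b → Dec (a <P b)) where

    climb : Fin p → Fin p → List (Fin p) → Fin p
    climb y c []       = c
    climb y c (e ∷ es) with e <? y | c <? e
    ... | yes _ | yes _ = climb y e es
    ... | _     | _     = climb y c es

    climb-spec : ∀ y c L → c <P y →
      climb y c L <P y × c ≤P climb y c L × (∀ e → e ∈ L → e <P y → ¬ (climb y c L <P e))
    climb-spec y c []       c<y = c<y , IsPartialOrder.refl isPartialOrder , λ _ ()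
    climb-spec y c (e ∷ es) c<y with e <? y | c <? e
    ... | yes e<y | yes c<e =
      let top<y , e≤top , maximal = climb-spec y e es e<y in
      top<y , ≤-trans (proj₁ c<e) e≤top ,
      λ { _ (here refl) _ top<e → <P-irrefl (≤-<P-trans e≤top top<e) ; e′ (there e′∈) → maximal e′ e′∈ }
    ... | yes _ | no c≮e =
      let top<y , c≤top , maximal = climb-spec y c es c<y in
      top<y , c≤top , λ { _ (here refl) _ top<e → c≮e (≤-<P-trans c≤top top<e) ; e′ (there e′∈) → maximal e′ e′∈ }
    ... | no e≮y | _ =
      let top<y , c≤top , maximal = climb-spec y c es c<y in
      top<y , c≤top , λ { _ (here refl) e<y _ → e≮y e<y ; e′ (there e′∈) → maximal e′ e′∈ }

    #below : Fin p → ℕ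
    #below y = count (λ w → does (w <? y)) (allFin p)

    chain-from-minimal′ : ∀ n y → #below y ℕ.< n → ∃ λ m → Minimal m × SatChain m y
    chain-from-minimal′ (suc n) y bound with FinP.any? (_<? y)
    ... | no nothing-below = y , (λ z z<y → nothing-below (z , z<y)) , single y
    ... | yes (z , z<y) =
      let c<y , _ , maximal = climb-spec y z (allFin p) z<y
          c = climb y z (allFin p)
          m , minimal , chain = chain-from-minimal′ n c (ℕP.<-≤-trans (fewer-below c<y) (ℕP.≤-pred bound))
      in m , minimal , extend chain (c<y , λ w c<w w<y → maximal w (∈-allFin w) w<y c<w)
      where
        fewer-below : ∀ {c} → c <P y → #below c ℕ.< #below y
        fewer-below {c} c<y = count-mono-< (λ w → does (w <? c)) (λ w → does (w <? y))
          (λ w w<c → dec-true (w <? y) (<-≤P-trans (sound w w<c) (proj₁ c<y)))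
          (dec-false (c <? c) <P-irrefl) (dec-true (c <? y) c<y) (∈-allFin c)
          where
            sound : ∀ w → does (w <? c) ≡ true → w <P c
            sound w h with w <? c
            ... | yes w<c = w<c

  -- <P need not be decidable; under a double negation we may assume it is.
  ¬¬-chain-from-minimal : ∀ y → ¬ ¬ (∃ λ m → Minimal m × SatChain m y)
  ¬¬-chain-from-minimal y k = ¬¬-∀-Fin (λ a → ¬¬-∀-Fin λ b → ¬¬-excluded-middle {A = a <P b})
    λ _<?_ → k (chain-from-minimal′ _<?_ (suc (#below _<?_ y)) y (ℕP.n<1+n _))

module CanonicalLabeling {p : ℕ} (P : LabeledPoset p) {r : ℤ} (can : LabeledPoset.Canonical P r) where
  open LabeledPoset P

  label≢0 : ∀ y → ω y ≢ 0ℤ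
  label≢0 y ωy≡0 with proj₂ can y
  ... | inj₁ (_ , ωy<0) = ℤP.<-irrefl refl (subst (ℤ._< 0ℤ) ωy≡0 ωy<0)
  ... | inj₂ (_ , 0<ωy) = ℤP.<-irrefl refl (subst (0ℤ ℤ.<_) ωy≡0 0<ωy)

  minimal-negative : ∀ x → Minimal x → ltᵇ (ω x) 0ℤ ≡ true
  minimal-negative x minimal with proj₂ can x
  ... | inj₁ (_ , ωx<0)  = ltᵇ-complete ωx<0
  ... | inj₂ (rank1 , _) with () ← rank1 x minimal (single x)

  maximal-rank : ∀ y → Maximal y → r ≡ + indicator (ltᵇ 0ℤ (ω y))
  maximal-rank y maximal = decidable-stable (r ℤP.≟ _) λ k →
    Chains.¬¬-chain-from-minimal P y λ (m , minimal , chain) →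
      k (trans (sym (proj₁ can m y minimal maximal chain)) (ρ m minimal chain))
    where
      ρ : ∀ m → Minimal m → (c : SatChain m y) → weight c ≡ + indicator (ltᵇ 0ℤ (ω y))
      ρ m minimal chain with proj₂ can y
      ... | inj₁ (rank0 , ωy<0) rewrite ltᵇ-asym (ω y) 0ℤ (ltᵇ-complete ωy<0) = rank0 m minimal chain
      ... | inj₂ (rank1 , 0<ωy) rewrite ltᵇ-complete 0<ωy = rank1 m minimal chain

precedes-not-first : ∀ {π : List ℤ} {a b} → Unique π → Precedes a b π → b ≢ headOr0 π
precedes-not-first {a = a} {b} (b∉ ∷ _) ([] , bs , cs , refl) refl = All.lookup b∉ (∈-++⁺ʳ bs (here refl)) refl
precedes-not-first {a = a} {b} (b∉ ∷ _) (b ∷ as , bs , cs , refl) refl =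
  All.lookup b∉ (∈-++⁺ʳ as (there (∈-++⁺ʳ bs (here refl)))) refl

lastOf-∈ : ∀ (p : ℤ) L → lastOf p L ∈ p ∷ L
lastOf-∈ p []      = here refl
lastOf-∈ p (a ∷ L) = there (lastOf-∈ a L)

precedes-not-last : ∀ {π : List ℤ} {a b} → Unique π → Precedes a b π → a ≢ lastOr0 π
precedes-not-last {a = a} {b} u (as , bs , cs , refl) a≡last =
  All.lookup (unique-∉-after as u) (∈-++⁺ʳ bs last∈) (sym a≡last)
  where
    last∈ : lastOr0 (as ++ a ∷ bs ++ b ∷ cs) ∈ b ∷ cs
    last∈ rewrite lastOr0≡lastOf (as ++ a ∷ bs ++ b ∷ cs) | lastOf-++ 0ℤ as (a ∷ bs ++ b ∷ cs)
                | lastOf-++ a bs (b ∷ cs) = lastOf-∈ b cs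

module LinearExtension {p : ℕ} .{{_ : NonZero p}} (P : LabeledPoset p) {r : ℤ} (can : LabeledPoset.Canonical P r)
                       {π : List ℤ} (jh : InJH P π) where
  open LabeledPoset P
  open CanonicalLabeling P can

  π↭labels : π ↭ map ω (allFin p)
  π↭labels = proj₁ jh

  π-unique : Unique π
  π-unique = unique-resp-↭ (UniqueP.map⁺ ω-injective (UniqueP.allFin⁺ p)) (↭-sym π↭labels)

  ∈-π⇒label : ∀ {a} → a ∈ π → ∃ λ y → a ≡ ω y
  ∈-π⇒label a∈ with ∈-map⁻ ω (PermP.∈-resp-↭ π↭labels a∈)
  ... | y , _ , a≡ωy = y , a≡ωy

  π-nonzero : All (_≢ 0ℤ) π
  π-nonzero = All.tabulate λ a∈ → let y , a≡ωy = ∈-π⇒label a∈ in λ a≡0 → label≢0 y (trans (sym a≡ωy) a≡0)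

  π-nonempty : ∃₂ λ a rest → π ≡ a ∷ rest
  π-nonempty = nonempty π↭labels
    where
      nonempty : ∀ {τ} → τ ↭ map ω (allFin p) → ∃₂ λ a rest → τ ≡ a ∷ rest
      nonempty {[]}       []↭ = ⊥-elim (ℕ.≢-nonZero⁻¹ p (sym (trans (PermP.↭-length []↭)
                                  (trans (ListP.length-map ω (allFin p)) (ListP.length-tabulate id)))))
      nonempty {a ∷ rest} _   = a , rest , refl

  first-negative : ltᵇ (headOr0 π) 0ℤ ≡ true
  first-negative with π-nonempty
  ... | a , rest , refl with ∈-π⇒label (here refl)
  ...   | x , refl = minimal-negative x λ y y<x → precedes-not-first π-unique (proj₂ jh y x y<x) refl

  rank≡last-positive : r ≡ + indicator (ltᵇ 0ℤ (lastOr0 π))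
  rank≡last-positive with π-nonempty
  ... | a , rest , refl with ∈-π⇒label (subst (_∈ a ∷ rest) (sym (lastOr0≡lastOf (a ∷ rest))) (lastOf-∈ a rest))
  ...   | y , last≡ωy rewrite last≡ωy = maximal-rank y λ z y<z → precedes-not-last π-unique (proj₂ jh y z y<z) (sym last≡ωy)

-- The orbit of a linear extension

peak≡count-peaks : ∀ τ → ltᵇ (headOr0 τ) 0ℤ ≡ true → ltᵇ 0ℤ (lastOr0 τ) ≡ false →
                   peak τ ≡ count isPeak (signature τ)
peak≡count-peaks (a ∷ rest) a<0 last≯0 rewrite peak-signature 0ℤ a rest last≯0 | ltᵇ-asym a 0ℤ a<0 = refl

valleys≡peaks+last<0 : ∀ τ → Unique τ → All (_≢ 0ℤ) τ → ltᵇ (headOr0 τ) 0ℤ ≡ true →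
  count isValley (signature τ) ≡ count isPeak (signature τ) ℕ.+ indicator (ltᵇ (lastOr0 τ) 0ℤ)
valleys≡peaks+last<0 (a ∷ rest) u ≢0 a<0 =
  sym (trans (peaks-valleys 0ℤ a rest (All.map ≢-sym ≢0 ∷ u) ≢0)
             (trans (cong (λ b → count isValley (signature (a ∷ rest)) ℕ.+ indicator b) (ltᵇ-asym a 0ℤ a<0))
                    (ℕP.+-identityʳ _)))

module Orbit {p : ℕ} .{{_ : NonZero p}} (P : LabeledPoset p) {r : ℤ} (can : LabeledPoset.Canonical P r)
             {π : List ℤ} (jh : InJH P π) where
  open LabeledPoset P using (ω)
  open CanonicalLabeling P can using (label≢0)
  open LinearExtension P can jh
  open Action P label≢0 π π-unique

  σ : Subset p → List ℤ
  σ S = ψS P S π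

  σ-sameEnds : ∀ S → SameEnds π (σ S)
  σ-sameEnds S = ψ-over-sameEnds S (allFin p)

  σ-unique : ∀ S → Unique (σ S)
  σ-unique S = ψ-over-unique S (allFin p)

  σ-nonzero : ∀ S → All (_≢ 0ℤ) (σ S)
  σ-nonzero S = PermP.All-resp-↭ (↭-sym (SameEnds.↭-original (σ-sameEnds S))) π-nonzero

  count-π : ∀ Q → count Q (signature π) ≡ ∑[ y < p ] indicator (Q (entry y))
  count-π Q = count-by-letters Q ω (signature π) (subst Unique (sym (letters-signatureFrom 0ℤ π)) π-unique)
    (subst (_↭ map ω (allFin p)) (sym (letters-signatureFrom 0ℤ π)) π↭labels)

  count-σ : ∀ Q S → count Q (signature (σ S)) ≡ ∑[ y < p ] indicator (Q (flipIf (lookup S y) (entry y)))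
  count-σ Q S = trans
    (count-by-letters Q ω (signature (σ S)) (subst Unique (sym (letters-signatureFrom 0ℤ (σ S))) (σ-unique S))
      (subst (_↭ map ω (allFin p)) (sym (letters-signatureFrom 0ℤ (σ S)))
        (↭-trans (SameEnds.↭-original (σ-sameEnds S)) π↭labels)))
    (sum-cong-≗ λ y → cong (indicator ∘ Q) (entryOf-ψS S y))

  lastPositive #peaks #movable : ℕ
  lastPositive = indicator (ltᵇ 0ℤ (lastOr0 π))
  #peaks       = ∑[ y < p ] indicator (isPeak (entry y))
  #movable     = ∑[ y < p ] indicator (isMovable (entry y))

  #doubleDescents : Subset p → ℕ
  #doubleDescents S = ∑[ y < p ] indicator (isDoubleDescent (flipIf (lookup S y) (entry y)))

  countDD-σ : ∀ S → countDD (0ℤ ∷ σ S ++ [ 0ℤ ]) ≡ #doubleDescents S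
  countDD-σ S = trans (countDD-signature 0ℤ (σ S) (All.map ≢-sym (σ-nonzero S) ∷ σ-unique S)) (count-σ isDoubleDescent S)

  -- A letter is followed by a smaller one in σ 0 iff it is a peak or a double descent, and flipping
  -- never changes whether a letter is a peak.
  des-σ : ∀ S → des (σ S) ℕ.+ lastPositive ≡ #peaks ℕ.+ #doubleDescents S
  des-σ S = begin
    des (σ S) ℕ.+ lastPositive
      ≡⟨ cong (λ b → des (σ S) ℕ.+ indicator b) (sym (SameEnds.last>0 (σ-sameEnds S))) ⟩
    des (σ S) ℕ.+ indicator (ltᵇ 0ℤ (lastOr0 (σ S)))
      ≡⟨ trans (des-signature 0ℤ (σ S)) (count-σ descends S) ⟩
    ∑[ y < p ] indicator (descends (flipIf (lookup S y) (entry y)))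
      ≡⟨ sum-cong-≗ (λ y → descends-split (lookup S y) (entry y)) ⟩
    ∑[ y < p ] (indicator (isPeak (entry y)) ℕ.+ indicator (isDoubleDescent (flipIf (lookup S y) (entry y))))
      ≡⟨ ∑-distrib-+ (λ y → indicator (isPeak (entry y))) _ ⟩
    #peaks ℕ.+ #doubleDescents S ∎
    where
      open ≡-Reasoning
      descends-split : ∀ b e →
        indicator (descends (flipIf b e)) ≡ indicator (isPeak e) ℕ.+ indicator (isDoubleDescent (flipIf b e))
      descends-split false (_ , true  , true)  = refl
      descends-split false (_ , true  , false) = refl
      descends-split false (_ , false , n)     = refl
      descends-split true  (_ , true  , true)  = refl
      descends-split true  (_ , true  , false) = refl
      descends-split true  (_ , false , true)  = refl
      descends-split true  (_ , false , false) = refl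

  noDD-exists : ∃ λ τ → InOrb P τ π × NoDD τ
  noDD-exists = σ D , (D , refl) , trans (countDD-σ D) (trans (sum-cong-≗ removed) (sum-replicate-zero p))
    where
      D = Vec.tabulate (isDoubleDescent ∘ entry)
      flip-removes : ∀ e → isDoubleDescent (flipIf (isDoubleDescent e) e) ≡ false
      flip-removes (_ , false , true)  = refl
      flip-removes (_ , false , false) = refl
      flip-removes (_ , true  , n)     = refl
      removed : ∀ y → indicator (isDoubleDescent (flipIf (lookup D y) (entry y))) ≡ 0
      removed y rewrite VecP.lookup∘tabulate (isDoubleDescent ∘ entry) y | flip-removes (entry y) = refl

  movable : Subset p
  movable = Vec.tabulate (isMovable ∘ entry)

  lookup-movable : ∀ y → lookup movable y ≡ isMovable (entry y)
  lookup-movable = VecP.lookup∘tabulate (isMovable ∘ entry)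

  restrict : Subset p → Subset p
  restrict S = Vec.zipWith _∧_ S movable

  lookup-restrict : ∀ S y → lookup (restrict S) y ≡ lookup S y ∧ isMovable (entry y)
  lookup-restrict S y = trans (VecP.lookup-zipWith _∧_ y S movable) (cong (lookup S y ∧_) (lookup-movable y))

  restrict-⊆ : ∀ S → restrict S ⊆ᵇ movable
  restrict-⊆ S y in-restriction =
    trans (lookup-movable y) (proj₂ (∧-true (trans (sym (lookup-restrict S y)) in-restriction)))

  σ-restrict : ∀ S → σ S ≡ σ (restrict S)
  σ-restrict S = ψ-over-movable S (restrict S) (allFin p) λ y mov →
    sym (trans (lookup-restrict S y) (trans (cong (lookup S y ∧_) mov) (∧-identityʳ (lookup S y))))

  σ-injective : ∀ {S S′} → S ⊆ᵇ movable → S′ ⊆ᵇ movable → σ S ≡ σ S′ → S ≡ S′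
  σ-injective {S} {S′} S⊆ S′⊆ σS≡σS′ = lookup-extensionality S S′ pointwise
    where
      pointwise : ∀ y → lookup S y ≡ lookup S′ y
      pointwise y with isMovable (entry y) in mov
      ... | true  = flipIf-injective (lookup S y) (lookup S′ y) (entry y) mov
          (trans (sym (entryOf-ψS S y)) (trans (cong (entryOf (ω y) ∘ signature) σS≡σS′) (entryOf-ψS S′ y)))
        where
          flipIf-injective : ∀ b b′ e → isMovable e ≡ true → flipIf b e ≡ flipIf b′ e → b ≡ b′
          flipIf-injective false false _                 _ _  = refl
          flipIf-injective true  true  _                 _ _  = refl
          flipIf-injective false true  (_ , true , false) _ ()
          flipIf-injective false true  (_ , false , true) _ ()
          flipIf-injective true  false (_ , true , false) _ ()
          flipIf-injective true  false (_ , false , true) _ ()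
      ... | false = trans (outside S S⊆) (sym (outside S′ S′⊆))
        where
          outside : ∀ T → T ⊆ᵇ movable → lookup T y ≡ false
          outside T T⊆ with lookup T y in Ty
          ... | false = refl
          ... | true with () ← trans (sym (T⊆ y Ty)) (trans (lookup-movable y) mov)

  orbit-↭ : orbit P π ↭ map σ (subsetsOf movable)
  orbit-↭ = ∼bag⇒↭ (unique∧set⇒bag (UniqueDecP.deduplicate-! (ListP.≡-dec ℤP._≟_) _)
    (map-unique-injectiveOn σ (subsetsOf movable) (subsetsOf-unique movable)
      (λ S∈ S′∈ → σ-injective (∈-subsetsOf⁻ movable _ S∈) (∈-subsetsOf⁻ movable _ S′∈)))
    (mk⇔ to from))
    where
      to : ∀ {τ} → τ ∈ orbit P π → τ ∈ map σ (subsetsOf movable)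
      to τ∈ with ∈-map⁻ σ (∈-deduplicate⁻ (ListP.≡-dec ℤP._≟_) _ τ∈)
      ... | S , _ , refl = subst (_∈ map σ (subsetsOf movable)) (sym (σ-restrict S))
                             (∈-map⁺ σ (∈-subsetsOf⁺ movable (restrict S) (restrict-⊆ S)))
      from : ∀ {τ} → τ ∈ map σ (subsetsOf movable) → τ ∈ orbit P π
      from τ∈ with ∈-map⁻ σ τ∈
      ... | S , _ , refl = ∈-deduplicate⁺ (ListP.≡-dec ℤP._≟_) (∈-map⁺ σ (∈-allSubsets p S))

  module _ (S₀ : Subset p) (noDD : NoDD (σ S₀)) where

    des-noDD : des (σ S₀) ℕ.+ lastPositive ≡ #peaks
    des-noDD = trans (des-σ S₀) (trans (cong (#peaks ℕ.+_) (trans (sym (countDD-σ S₀)) noDD)) (ℕP.+-identityʳ #peaks))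

    des-σ-noDD : ∀ S → des (σ S) ≡ des (σ S₀) ℕ.+ #doubleDescents S
    des-σ-noDD S = ℕP.+-cancelʳ-≡ lastPositive _ _ (begin
      des (σ S) ℕ.+ lastPositive                              ≡⟨ des-σ S ⟩
      #peaks ℕ.+ #doubleDescents S                            ≡⟨ cong (ℕ._+ #doubleDescents S) (sym des-noDD) ⟩
      des (σ S₀) ℕ.+ lastPositive ℕ.+ #doubleDescents S       ≡⟨ ℕP.+-assoc (des (σ S₀)) lastPositive _ ⟩
      des (σ S₀) ℕ.+ (lastPositive ℕ.+ #doubleDescents S)     ≡⟨ cong (des (σ S₀) ℕ.+_) (ℕP.+-comm lastPositive _) ⟩
      des (σ S₀) ℕ.+ (#doubleDescents S ℕ.+ lastPositive)     ≡⟨ ℕP.+-assoc (des (σ S₀)) _ lastPositive ⟨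
      des (σ S₀) ℕ.+ #doubleDescents S ℕ.+ lastPositive       ∎)
      where open ≡-Reasoning

    orbitPoly-noDD : ∀ t → orbitPoly P π t ≡ t ^ des (σ S₀) * (1ℤ + t) ^ #movable
    orbitPoly-noDD t = begin
      sumℤ (map (λ τ → t ^ des τ) (orbit P π))
        ≡⟨ sumℤ-↭ (PermP.map⁺ (λ τ → t ^ des τ) orbit-↭) ⟩
      sumℤ (map (λ τ → t ^ des τ) (map σ (subsetsOf movable)))
        ≡⟨ cong sumℤ (trans (sym (ListP.map-∘ (subsetsOf movable))) (ListP.map-cong split (subsetsOf movable))) ⟩
      sumℤ (map (λ S → t ^ des (σ S₀) * t ^ #doubleDescents S) (subsetsOf movable))
        ≡⟨ sumℤ-*ˡ (t ^ des (σ S₀)) (λ S → t ^ #doubleDescents S) (subsetsOf movable) ⟩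
      t ^ des (σ S₀) * sumℤ (map (λ S → t ^ #doubleDescents S) (subsetsOf movable))
        ≡⟨ cong (t ^ des (σ S₀) *_)
                (sum-over-subsets movable (λ y b → indicator (isDoubleDescent (flipIf b (entry y)))) t both-orientations unmoved) ⟩
      t ^ des (σ S₀) * (1ℤ + t) ^ ∑[ y < p ] indicator (lookup movable y)
        ≡⟨ cong (λ k → t ^ des (σ S₀) * (1ℤ + t) ^ k) (sum-cong-≗ (cong indicator ∘ lookup-movable)) ⟩
      t ^ des (σ S₀) * (1ℤ + t) ^ #movable ∎
      where
        open ≡-Reasoning
        split : ∀ S → t ^ des (σ S) ≡ t ^ des (σ S₀) * t ^ #doubleDescents S
        split S = trans (cong (t ^_) (des-σ-noDD S)) (ℤP.^-distribˡ-+-* t (des (σ S₀)) (#doubleDescents S))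
        -- a movable letter is a double descent in exactly one of its two orientations
        both-orientations : ∀ y → lookup movable y ≡ true →
          t ^ indicator (isDoubleDescent (entry y)) + t ^ indicator (isDoubleDescent (flipIf true (entry y))) ≡ 1ℤ + t
        both-orientations y mov with entry y | trans (sym (lookup-movable y)) mov
        ... | (_ , true  , false) | _ = cong (λ s → 1ℤ + s) (ℤP.*-identityʳ t)
        ... | (_ , false , true)  | _ = trans (cong (_+ 1ℤ) (ℤP.*-identityʳ t)) (ℤP.+-comm t 1ℤ)
        unmoved : ∀ y → lookup movable y ≡ false → indicator (isDoubleDescent (entry y)) ≡ 0
        unmoved y unmov with entry y | trans (sym (lookup-movable y)) unmov
        ... | (_ , true  , true)  | _ = refl
        ... | (_ , false , false) | _ = refl

    -- Every letter is a peak, a valley or movable, and in 0 π 0 the valleys outnumber the peaks by one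
    -- exactly when the last letter is negative.
    length-noDD : p ≡ #movable ℕ.+ lastPositive ℕ.+ 1 ℕ.+ 2 ℕ.* des (σ S₀)
    length-noDD = begin
      p                                      ≡⟨ sym (∑-const-1 p) ⟩
      ∑[ y < p ] 1                           ≡⟨ sum-cong-≗ (λ y → sym (peak-valley-movable (entry y))) ⟩
      ∑[ y < p ] (indicator (isPeak (entry y)) ℕ.+ indicator (isValley (entry y)) ℕ.+ indicator (isMovable (entry y)))
        ≡⟨ trans (∑-distrib-+ (λ y → indicator (isPeak (entry y)) ℕ.+ indicator (isValley (entry y))) _)
                 (cong (ℕ._+ #movable) (∑-distrib-+ (λ y → indicator (isPeak (entry y))) _)) ⟩
      #peaks ℕ.+ #valleys ℕ.+ #movable       ≡⟨ cong (λ v → #peaks ℕ.+ v ℕ.+ #movable) valleys ⟩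
      #peaks ℕ.+ (#peaks ℕ.+ lastNegative) ℕ.+ #movable
        ≡⟨ cong (λ k → k ℕ.+ (k ℕ.+ lastNegative) ℕ.+ #movable) (sym des-noDD) ⟩
      d ℕ.+ lastPositive ℕ.+ (d ℕ.+ lastPositive ℕ.+ lastNegative) ℕ.+ #movable
        ≡⟨ regroup d lastPositive lastNegative #movable ⟩
      #movable ℕ.+ lastPositive ℕ.+ (lastNegative ℕ.+ lastPositive) ℕ.+ 2 ℕ.* d
        ≡⟨ cong (λ k → #movable ℕ.+ lastPositive ℕ.+ k ℕ.+ 2 ℕ.* d) last-sign ⟩
      #movable ℕ.+ lastPositive ℕ.+ 1 ℕ.+ 2 ℕ.* d ∎
      where
        open ≡-Reasoning
        d = des (σ S₀)
        lastNegative = indicator (ltᵇ (lastOr0 π) 0ℤ)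
        #valleys = ∑[ y < p ] indicator (isValley (entry y))
        valleys : #valleys ≡ #peaks ℕ.+ lastNegative
        valleys = trans (sym (count-π isValley)) (trans (valleys≡peaks+last<0 π π-unique π-nonzero first-negative)
                    (cong (ℕ._+ lastNegative) (count-π isPeak)))
        regroup : ∀ d c l m → d ℕ.+ c ℕ.+ (d ℕ.+ c ℕ.+ l) ℕ.+ m ≡ m ℕ.+ c ℕ.+ (l ℕ.+ c) ℕ.+ 2 ℕ.* d
        regroup = ℕSolver.solve-∀
        last-sign : lastNegative ℕ.+ lastPositive ≡ 1
        last-sign with π-nonempty
        ... | a , rest , refl with compare≢ (lastOr0 (a ∷ rest)) 0ℤ
              (All.lookup π-nonzero (subst (_∈ a ∷ rest) (sym (lastOr0≡lastOf (a ∷ rest))) (lastOf-∈ a rest)))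
        ...   | less    l<0 0≮l rewrite l<0 | 0≮l = refl
        ...   | greater l≮0 0<l rewrite l≮0 | 0<l = refl

    exponent-noDD : + p - r - 1ℤ - + 2 * + des (σ S₀) ≡ + #movable
    exponent-noDD = begin
      + p - r - 1ℤ - + 2 * + d
        ≡⟨ cong₂ (λ n r → n - r - 1ℤ - + 2 * + d) (cong +_ length-noDD) rank≡last-positive ⟩
      + (#movable ℕ.+ lastPositive ℕ.+ 1 ℕ.+ 2 ℕ.* d) - + lastPositive - 1ℤ - + 2 * + d
        ≡⟨ cancel #movable lastPositive d ⟩
      + #movable ∎
      where
        open ≡-Reasoning
        d = des (σ S₀)
        cancelℤ : ∀ (M C D : ℤ) → M + C + 1ℤ + + 2 * D - C - 1ℤ - + 2 * D ≡ M
        cancelℤ = ℤSolver.solve-∀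
        cancel : ∀ m c d → + (m ℕ.+ c ℕ.+ 1 ℕ.+ 2 ℕ.* d) - + c - 1ℤ - + 2 * + d ≡ + m
        cancel m c d = trans (cong (λ z → z - + c - 1ℤ - + 2 * + d) embed) (cancelℤ (+ m) (+ c) (+ d))
          where
            embed : + (m ℕ.+ c ℕ.+ 1 ℕ.+ 2 ℕ.* d) ≡ + m + + c + 1ℤ + + 2 * + d
            embed = trans (ℤP.pos-+ (m ℕ.+ c ℕ.+ 1) (2 ℕ.* d))
              (cong₂ _+_ (trans (ℤP.pos-+ (m ℕ.+ c) 1) (cong (_+ 1ℤ) (ℤP.pos-+ m c))) (ℤP.pos-* 2 d))

  module _ (r≡0 : r ≡ 0ℤ) where

    last≯0 : ltᵇ 0ℤ (lastOr0 π) ≡ false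
    last≯0 with ltᵇ 0ℤ (lastOr0 π) | rank≡last-positive
    ... | false | _ = refl
    ... | true  | r≡1 with () ← trans (sym r≡0) r≡1

    peak-π : peak π ≡ #peaks
    peak-π = trans (peak≡count-peaks π first-negative last≯0) (count-π isPeak)

    peak-σ : ∀ S → peak (σ S) ≡ #peaks
    peak-σ S = begin
      peak (σ S)
        ≡⟨ peak≡count-peaks (σ S) (trans head<0 first-negative) (trans last>0 last≯0) ⟩
      count isPeak (signature (σ S))
        ≡⟨ count-σ isPeak S ⟩
      ∑[ y < p ] indicator (isPeak (flipIf (lookup S y) (entry y)))
        ≡⟨ sum-cong-≗ (λ y → cong indicator (isPeak-flipIf (lookup S y) (entry y))) ⟩
      #peaks ∎
      where
        open ≡-Reasoning
        open SameEnds (σ-sameEnds S)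
        isPeak-flipIf : ∀ b e → isPeak (flipIf b e) ≡ isPeak e
        isPeak-flipIf false e           = refl
        isPeak-flipIf true  (a , l , n) = ∧-comm n l

    peak≡des-noDD : ∀ S₀ → NoDD (σ S₀) → peak π ≡ des (σ S₀)
    peak≡des-noDD S₀ noDD = trans peak-π (sym (trans (sym (ℕP.+-identityʳ (des (σ S₀))))
      (trans (cong (des (σ S₀) ℕ.+_) (sym (cong indicator last≯0))) (des-noDD S₀ noDD))))

theorem6p3 : ∀ {p : ℕ} → .{{_ : NonZero p}} → (P : LabeledPoset p) → (r : ℤ) →
    LabeledPoset.Canonical P r → (π : List ℤ) → InJH P π →
    (∃ λ σ → InOrb P σ π × NoDD σ)
    × (∀ σ → InOrb P σ π → NoDD σ →
         ∃ λ (m : ℕ) → ((+ p) - r - 1ℤ - (+ 2) * (+ des σ) ≡ + m)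
                      × (∀ (t : ℤ) → orbitPoly P π t ≡ (t ^ des σ) * ((1ℤ + t) ^ m)))
    × (r ≡ 0ℤ → (∀ σ → InOrb P σ π → peak σ ≡ peak π)
               × (∀ σ → InOrb P σ π → NoDD σ → peak π ≡ des σ))
theorem6p3 P r can π jh =
    noDD-exists
  , (λ { _ (S₀ , refl) noDD → #movable , exponent-noDD S₀ noDD , orbitPoly-noDD S₀ noDD })
  , λ r≡0 → (λ { _ (S , refl) → trans (peak-σ r≡0 S) (sym (peak-π r≡0)) })
          , (λ { _ (S₀ , refl) noDD → peak≡des-noDD r≡0 S₀ noDD })
  where open Orbit P can jh
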